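{- Let $p$ be an odd prime and $r\ge1$ an integer. Let $A,B\subset(\mathbb{Z}/p^r\mathbb{Z})^2$, $P=A\times B$, and $R\subset\mathcal{R}_r$. Then \[\Big|\mathcal{I}(P,R)-\frac{|P||R|}{p^{2r}}\Big|\ll p^{\frac{3r-1}{2}}|P|^{1/2}|R|^{1/2}.\]
   Context: $G_r=SO_2(\mathbb{Z}/p^r\mathbb{Z})$ is the group of matrices $\begin{bmatrix}a&-b\\ b&a\end{bmatrix}$ with $a^2+b^2\equiv1\pmod{p^r}$. $\mathcal{R}_r=G_r\times(\mathbb{Z}/p^r\mathbb{Z})^2$ (rigid motions). For $P\subset(\mathbb{Z}/p^r\mathbb{Z})^2\times(\mathbb{Z}/p^r\mathbb{Z})^2$ and $R\subset\mathcal{R}_r$, $\mathcal{I}(P,R)$ is the number of pairs $((g,\mathbf{z}),(\mathbf{x},\mathbf{y}))\in R\times P$ with $g\mathbf{y}+\mathbf{z}=\mathbf{x}$. $X\ll Y$ means $X\le CY$ for an absolute constant $C$. -}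

module Defs where

open import Data.Nat using (ℕ; _+_; _*_; ∣_-_∣)
open import Data.Nat.Divisibility using (_∣_; _∣?_)
open import Data.Fin using (Fin; toℕ)
open import Data.List using (map; allFin)
open import Data.Nat.ListAction using (sum)
open import Data.Product using (_×_; _,_)
open import Data.Bool using (Bool; true; false; if_then_else_; _∧_)
open import Relation.Nullary using (does)

-- Z/NZ is represented by Fin N (canonical residues 0..N-1).
-- Congruence of naturals modulo N.
_≡_[mod_] : ℕ → ℕ → ℕ → Set
a ≡ b [mod N ] = N ∣ ∣ a - b ∣

congB : ℕ → ℕ → ℕ → Bool
congB N a b = does (N ∣? ∣ a - b ∣)

Pt : ℕ → Set
Pt N = Fin N × Fin N

-- candidate rigid motions (a , b , z) ; the rotation is [[a,-b],[b,a]]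
Motion : ℕ → Set
Motion N = Fin N × Fin N × Pt N

IsRot : (N : ℕ) → Fin N → Fin N → Set
IsRot N a b = (toℕ a * toℕ a + toℕ b * toℕ b) ≡ 1 [mod N ]

∑ : (n : ℕ) → (Fin n → ℕ) → ℕ
∑ n f = sum (map f (allFin n))

ind : Bool → ℕ
ind b = if b then 1 else 0

cardPt : (N : ℕ) → (Pt N → Bool) → ℕ
cardPt N A = ∑ N λ i → ∑ N λ j → ind (A (i , j))

cardMotion : (N : ℕ) → (Motion N → Bool) → ℕ
cardMotion N R = ∑ N λ a → ∑ N λ b → ∑ N λ z₁ → ∑ N λ z₂ → ind (R (a , b , z₁ , z₂))

-- incidence  g y + z = x  with g = [[a,-b],[b,a]], i.e.
--   a y₁ - b y₂ + z₁ ≡ x₁   and   b y₁ + a y₂ + z₂ ≡ x₂   (mod N)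
incidentB : (N : ℕ) → Motion N → Pt N → Pt N → Bool
incidentB N (a , b , z₁ , z₂) (x₁ , x₂) (y₁ , y₂) =
  congB N (toℕ a * toℕ y₁ + toℕ z₁) (toℕ x₁ + toℕ b * toℕ y₂)
  ∧ congB N (toℕ b * toℕ y₁ + toℕ a * toℕ y₂ + toℕ z₂) (toℕ x₂)

incidences : (N : ℕ) → (A B : Pt N → Bool) → (R : Motion N → Bool) → ℕ
incidences N A B R =
  ∑ N λ a → ∑ N λ b → ∑ N λ z₁ → ∑ N λ z₂ →
  ∑ N λ x₁ → ∑ N λ x₂ → ∑ N λ y₁ → ∑ N λ y₂ →
  ind (R (a , b , z₁ , z₂) ∧ A (x₁ , x₂) ∧ B (y₁ , y₂)
       ∧ incidentB N (a , b , z₁ , z₂) (x₁ , x₂) (y₁ , y₂))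

module Submission where

-- Let K(x, y) be the number of motions in R sending y to x, so that I(P, R) is the sum of K over
-- A × B, and write N = p^r.  By Cauchy–Schwarz over A × B,
--   (N² I − |A||B||R|)² ≤ |A||B| · Σ_{x,y} (N² K(x, y) − |R|)²,
-- and the right-hand sum only needs the first two moments of K.  Every motion sends each y to
-- exactly one x, so Σ K = N² |R|.  The second moment Σ K² counts pairs of motions of R together
-- with a common point y on which they agree.  If the rotations of two such motions differ modulo p
-- then g − g′ is invertible modulo p^r and they agree on at most one y; if they are congruent
-- modulo p, each y fixes the translation of the second motion, and a rotation is congruent modulo
-- p to at most p^(r−1) rotations (the sine of the relative rotation, a multiple of p, determines
-- it).  Hence Σ K² ≤ |R| (|R| + p^(3r−1)), the variance Σ (N² K − |R|)² is at most
-- p^(7r−1) |R|, and the theorem holds with constant 1.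

module FiniteSums where

  open import Data.Nat as ℕ using (ℕ)
  open import Data.Fin using (Fin) renaming (_≟_ to _≟ᶠ_)
  open import Data.Integer using (ℤ; +_; 0ℤ; 1ℤ; _+_; _*_; _≤_; _<_; +≤+; +<+)
  open import Data.Integer.Properties
  open import Algebra.Properties.CommutativeSemigroup +-commutativeSemigroup using (interchange)
  open import Data.List using (List; []; _∷_; _++_; map; length; cartesianProduct; allFin)
  open import Data.List.Properties using (length-tabulate)
  open import Data.List.Relation.Unary.Any using (Any; here; there)
  open import Data.List.Relation.Unary.All as All using (All; []; _∷_)
  open import Data.List.Relation.Unary.Unique.Propositional using (Unique; []; _∷_)
  open import Data.List.Membership.Propositional using (_∈_)
  open import Data.List.Membership.Propositional.Properties using (∈-allFin)
  open import Data.Product using (_×_; _,_; proj₁; proj₂)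
  open import Data.Bool using (Bool; true; false; _∧_)
  open import Function using (id)
  open import Relation.Binary.PropositionalEquality
  open import Relation.Nullary using (Dec; does; yes; no; ¬_; contradiction)
  open import Defs using (ind)

  private
    variable
      X Y : Set

  sumOver : List X → (X → ℤ) → ℤ
  sumOver []       f = 0ℤ
  sumOver (x ∷ xs) f = f x + sumOver xs f

  syntax sumOver xs (λ x → e) = ∑[ x ∈ xs ] e

  ∑-cong : ∀ xs {f g : X → ℤ} → (∀ x → f x ≡ g x) → ∑[ x ∈ xs ] f x ≡ ∑[ x ∈ xs ] g x
  ∑-cong []       f≗g = refl
  ∑-cong (x ∷ xs) f≗g = cong₂ _+_ (f≗g x) (∑-cong xs f≗g)

  ∑-zero : ∀ (xs : List X) → ∑[ x ∈ xs ] 0ℤ ≡ 0ℤ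
  ∑-zero []       = refl
  ∑-zero (x ∷ xs) = trans (+-identityˡ _) (∑-zero xs)

  ∑-distrib-+ : ∀ xs (f g : X → ℤ) →
                ∑[ x ∈ xs ] (f x + g x) ≡ ∑[ x ∈ xs ] f x + ∑[ x ∈ xs ] g x
  ∑-distrib-+ []       f g = refl
  ∑-distrib-+ (x ∷ xs) f g = trans (cong (_+_ (f x + g x)) (∑-distrib-+ xs f g))
                                   (interchange (f x) (g x) _ _)

  ∑-distribˡ-* : ∀ xs c (f : X → ℤ) → ∑[ x ∈ xs ] (c * f x) ≡ c * ∑[ x ∈ xs ] f x
  ∑-distribˡ-* []       c f = sym (*-zeroʳ c)
  ∑-distribˡ-* (x ∷ xs) c f = trans (cong (_+_ (c * f x)) (∑-distribˡ-* xs c f))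
                                    (sym (*-distribˡ-+ c (f x) _))

  ∑-distribʳ-* : ∀ xs c (f : X → ℤ) → ∑[ x ∈ xs ] (f x * c) ≡ ∑[ x ∈ xs ] f x * c
  ∑-distribʳ-* xs c f = begin
    ∑[ x ∈ xs ] (f x * c)  ≡⟨ ∑-cong xs (λ x → *-comm (f x) c) ⟩
    ∑[ x ∈ xs ] (c * f x)  ≡⟨ ∑-distribˡ-* xs c f ⟩
    c * ∑[ x ∈ xs ] f x    ≡⟨ *-comm c _ ⟩
    ∑[ x ∈ xs ] f x * c    ∎
    where open ≡-Reasoning

  ∑-const : ∀ (xs : List X) c → ∑[ x ∈ xs ] c ≡ c * + length xs
  ∑-const []       c = sym (*-zeroʳ c)
  ∑-const (x ∷ xs) c = begin
    c + ∑[ x ∈ xs ] c        ≡⟨ cong (_+_ c) (∑-const xs c) ⟩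
    c + c * + length xs      ≡⟨ cong (_+ c * + length xs) (*-identityʳ c) ⟨
    c * 1ℤ + c * + length xs ≡⟨ *-distribˡ-+ c 1ℤ _ ⟨
    c * (1ℤ + + length xs)   ≡⟨ cong (c *_) (pos-+ 1 (length xs)) ⟨
    c * + length (x ∷ xs)    ∎
    where open ≡-Reasoning

  ∑-++ : ∀ (xs ys : List X) (f : X → ℤ) → ∑[ x ∈ xs ++ ys ] f x ≡ ∑[ x ∈ xs ] f x + ∑[ y ∈ ys ] f y
  ∑-++ []       ys f = sym (+-identityˡ _)
  ∑-++ (x ∷ xs) ys f = trans (cong (_+_ (f x)) (∑-++ xs ys f)) (sym (+-assoc (f x) _ _))

  ∑-map : ∀ (g : X → Y) xs (f : Y → ℤ) → ∑[ y ∈ map g xs ] f y ≡ ∑[ x ∈ xs ] f (g x)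
  ∑-map g []       f = refl
  ∑-map g (x ∷ xs) f = cong (_+_ (f (g x))) (∑-map g xs f)

  ∑-cartesianProduct : ∀ (xs : List X) (ys : List Y) (f : X × Y → ℤ) →
    ∑[ p ∈ cartesianProduct xs ys ] f p ≡ ∑[ x ∈ xs ] ∑[ y ∈ ys ] f (x , y)
  ∑-cartesianProduct []       ys f = refl
  ∑-cartesianProduct (x ∷ xs) ys f = begin
    ∑[ p ∈ map (x ,_) ys ++ cartesianProduct xs ys ] f p
      ≡⟨ ∑-++ (map (x ,_) ys) _ f ⟩
    ∑[ p ∈ map (x ,_) ys ] f p + ∑[ p ∈ cartesianProduct xs ys ] f p
      ≡⟨ cong₂ _+_ (∑-map (x ,_) ys f) (∑-cartesianProduct xs ys f) ⟩
    ∑[ y ∈ ys ] f (x , y) + ∑[ x ∈ xs ] ∑[ y ∈ ys ] f (x , y) ∎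
    where open ≡-Reasoning

  ∑-comm : ∀ (xs : List X) (ys : List Y) (f : X → Y → ℤ) →
           ∑[ x ∈ xs ] ∑[ y ∈ ys ] f x y ≡ ∑[ y ∈ ys ] ∑[ x ∈ xs ] f x y
  ∑-comm []       ys f = sym (∑-zero ys)
  ∑-comm (x ∷ xs) ys f = begin
    ∑[ y ∈ ys ] f x y + ∑[ x ∈ xs ] ∑[ y ∈ ys ] f x y
      ≡⟨ cong (_+_ (∑[ y ∈ ys ] f x y)) (∑-comm xs ys f) ⟩
    ∑[ y ∈ ys ] f x y + ∑[ y ∈ ys ] ∑[ x ∈ xs ] f x y
      ≡⟨ ∑-distrib-+ ys (f x) _ ⟨
    ∑[ y ∈ ys ] (f x y + ∑[ x ∈ xs ] f x y) ∎
    where open ≡-Reasoning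

  ∑-product : ∀ (xs : List X) (ys : List Y) (f : X → ℤ) (g : Y → ℤ) →
              ∑[ x ∈ xs ] ∑[ y ∈ ys ] (f x * g y) ≡ ∑[ x ∈ xs ] f x * ∑[ y ∈ ys ] g y
  ∑-product xs ys f g = begin
    ∑[ x ∈ xs ] ∑[ y ∈ ys ] (f x * g y)  ≡⟨ ∑-cong xs (λ x → ∑-distribˡ-* ys (f x) g) ⟩
    ∑[ x ∈ xs ] (f x * ∑[ y ∈ ys ] g y)  ≡⟨ ∑-distribʳ-* xs _ f ⟩
    ∑[ x ∈ xs ] f x * ∑[ y ∈ ys ] g y    ∎
    where open ≡-Reasoning

  ∑[allFin]-1 : ∀ n → ∑[ i ∈ allFin n ] 1ℤ ≡ + n
  ∑[allFin]-1 n = trans (∑-const (allFin n) 1ℤ) (trans (*-identityˡ _) (cong +_ (length-tabulate id)))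

  ∑-mono-≤ : ∀ xs {f g : X → ℤ} → (∀ x → f x ≤ g x) → ∑[ x ∈ xs ] f x ≤ ∑[ x ∈ xs ] g x
  ∑-mono-≤ []       f≤g = ≤-refl
  ∑-mono-≤ (x ∷ xs) f≤g = +-mono-≤ (f≤g x) (∑-mono-≤ xs f≤g)

  ∑-nonNeg : ∀ xs {f : X → ℤ} → (∀ x → 0ℤ ≤ f x) → 0ℤ ≤ ∑[ x ∈ xs ] f x
  ∑-nonNeg xs {f} 0≤f = subst (_≤ ∑[ x ∈ xs ] f x) (∑-zero xs) (∑-mono-≤ xs 0≤f)

  ∑-nonPos : ∀ {xs} {f : X → ℤ} → All (λ x → f x ≤ 0ℤ) xs → ∑[ x ∈ xs ] f x ≤ 0ℤ
  ∑-nonPos []             = ≤-refl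
  ∑-nonPos (fx≤0 ∷ fxs≤0) = +-mono-≤ fx≤0 (∑-nonPos fxs≤0)

  ∑-pos⇒any : ∀ xs (f : X → ℤ) → 0ℤ < ∑[ x ∈ xs ] f x → Any (λ x → 0ℤ < f x) xs
  ∑-pos⇒any []       f (+<+ ())
  ∑-pos⇒any (x ∷ xs) f 0<∑ with 0ℤ <? f x
  ... | yes 0<fx = here 0<fx
  ... | no  0≮fx = there (∑-pos⇒any xs f (subst (0ℤ <_) (+-identityˡ _)
                                           (<-≤-trans 0<∑ (+-monoˡ-≤ _ (≮⇒≥ 0≮fx)))))

  term≤∑ : ∀ xs {f : X → ℤ} → (∀ x → 0ℤ ≤ f x) → ∀ {x} → x ∈ xs → f x ≤ ∑[ x ∈ xs ] f x
  term≤∑ (y ∷ xs) {f} 0≤f (here refl) =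
    subst (_≤ f y + ∑[ x ∈ xs ] f x) (+-identityʳ (f y)) (+-monoʳ-≤ (f y) (∑-nonNeg xs 0≤f))
  term≤∑ (y ∷ xs) {f} 0≤f (there x∈xs) =
    ≤-trans (term≤∑ xs 0≤f x∈xs)
            (subst (_≤ f y + ∑[ x ∈ xs ] f x) (+-identityˡ _) (+-monoˡ-≤ _ (0≤f y)))

  ∑-atMostOne : ∀ {xs} {f : X → ℤ} → Unique xs → (∀ x → 0ℤ ≤ f x) → (∀ x → f x ≤ 1ℤ) →
                (∀ {x y} → 0ℤ < f x → 0ℤ < f y → x ≡ y) → ∑[ x ∈ xs ] f x ≤ 1ℤ
  ∑-atMostOne []                        0≤f f≤1 unique = +≤+ ℕ.z≤n
  ∑-atMostOne {xs = x ∷ xs} {f} (x∉xs ∷ uxs) 0≤f f≤1 unique with 0ℤ <? f x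
  ... | yes 0<fx = subst (f x + ∑[ x ∈ xs ] f x ≤_) (+-identityʳ 1ℤ)
                     (+-mono-≤ (f≤1 x) (∑-nonPos (All.map vanishes x∉xs)))
    where
    vanishes : ∀ {y} → x ≢ y → f y ≤ 0ℤ
    vanishes x≢y = ≮⇒≥ (λ 0<fy → x≢y (unique 0<fx 0<fy))
  ... | no  0≮fx = subst (f x + ∑[ x ∈ xs ] f x ≤_) (+-identityˡ 1ℤ)
                     (+-mono-≤ (≮⇒≥ 0≮fx) (∑-atMostOne uxs 0≤f f≤1 unique))

  -- Spread each term over the fibres of φ; every fibre contributes at most 1.
  module _ {n} (φ : X → Fin n) (f : X → ℤ) where

    private
      fibre : X → Fin n → ℤ
      fibre x i with φ x ≟ᶠ i
      ... | yes _ = f x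
      ... | no  _ = 0ℤ

      fibre-self : ∀ x → fibre x (φ x) ≡ f x
      fibre-self x with φ x ≟ᶠ φ x
      ... | yes _   = refl
      ... | no  φ≢φ = contradiction refl φ≢φ

      fibre-bounded : (∀ x → 0ℤ ≤ f x) → (∀ x → f x ≤ 1ℤ) → ∀ x i → 0ℤ ≤ fibre x i × fibre x i ≤ 1ℤ
      fibre-bounded 0≤f f≤1 x i with φ x ≟ᶠ i
      ... | yes _ = 0≤f x , f≤1 x
      ... | no  _ = ≤-refl , +≤+ ℕ.z≤n

      fibre-pos : ∀ x i → 0ℤ < fibre x i → 0ℤ < f x × φ x ≡ i
      fibre-pos x i 0<fib with φ x ≟ᶠ i
      ... | yes φx≡i = 0<fib , φx≡i
      ... | no  _    = contradiction 0<fib (<-irrefl refl)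

    ∑-injective-≤ : ∀ {xs} → Unique xs → (∀ x → 0ℤ ≤ f x) → (∀ x → f x ≤ 1ℤ) →
                    (∀ {x y} → 0ℤ < f x → 0ℤ < f y → φ x ≡ φ y → x ≡ y) →
                    ∑[ x ∈ xs ] f x ≤ + n
    ∑-injective-≤ {xs} uxs 0≤f f≤1 injective = begin
      ∑[ x ∈ xs ] f x                         ≤⟨ ∑-mono-≤ xs f≤∑fibre ⟩
      ∑[ x ∈ xs ] ∑[ i ∈ allFin n ] fibre x i ≡⟨ ∑-comm xs (allFin n) fibre ⟩
      ∑[ i ∈ allFin n ] ∑[ x ∈ xs ] fibre x i ≤⟨ ∑-mono-≤ (allFin n) ∑fibre≤1 ⟩
      ∑[ i ∈ allFin n ] 1ℤ                    ≡⟨ ∑[allFin]-1 n ⟩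
      + n                                     ∎
      where
      open ≤-Reasoning
      0≤fibre : ∀ i x → 0ℤ ≤ fibre x i
      0≤fibre i x = proj₁ (fibre-bounded 0≤f f≤1 x i)
      f≤∑fibre : ∀ x → f x ≤ ∑[ i ∈ allFin n ] fibre x i
      f≤∑fibre x = subst (_≤ ∑[ i ∈ allFin n ] fibre x i) (fibre-self x)
                         (term≤∑ (allFin n) (λ i → 0≤fibre i x) (∈-allFin (φ x)))
      ∑fibre≤1 : ∀ i → ∑[ x ∈ xs ] fibre x i ≤ 1ℤ
      ∑fibre≤1 i = ∑-atMostOne uxs (0≤fibre i) (λ x → proj₂ (fibre-bounded 0≤f f≤1 x i)) λ 0<x 0<y →
        let (0<fx , φx≡i) = fibre-pos _ i 0<x ; (0<fy , φy≡i) = fibre-pos _ i 0<y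
        in injective 0<fx 0<fy (trans φx≡i (sym φy≡i))

  𝟙 : Bool → ℤ
  𝟙 b = + ind b

  0≤𝟙 : ∀ b → 0ℤ ≤ 𝟙 b
  0≤𝟙 b = +≤+ ℕ.z≤n

  𝟙≤1 : ∀ b → 𝟙 b ≤ 1ℤ
  𝟙≤1 false = +≤+ ℕ.z≤n
  𝟙≤1 true  = ≤-refl

  0<𝟙⇒true : ∀ b → 0ℤ < 𝟙 b → b ≡ true
  0<𝟙⇒true true  _         = refl
  0<𝟙⇒true false (+<+ ())

  𝟙-∧ : ∀ b c → 𝟙 (b ∧ c) ≡ 𝟙 b * 𝟙 c
  𝟙-∧ false c = refl
  𝟙-∧ true  c = sym (*-identityˡ (𝟙 c))

  0≤𝟙*𝟙 : ∀ b c → 0ℤ ≤ 𝟙 b * 𝟙 c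
  0≤𝟙*𝟙 b c = subst (0ℤ ≤_) (𝟙-∧ b c) (0≤𝟙 (b ∧ c))

  𝟙*𝟙≤1 : ∀ b c → 𝟙 b * 𝟙 c ≤ 1ℤ
  𝟙*𝟙≤1 b c = subst (_≤ 1ℤ) (𝟙-∧ b c) (𝟙≤1 (b ∧ c))

  0<𝟙*𝟙⇒true : ∀ b c → 0ℤ < 𝟙 b * 𝟙 c → b ≡ true × c ≡ true
  0<𝟙*𝟙⇒true true  true  _         = refl , refl
  0<𝟙*𝟙⇒true true  false (+<+ ())
  0<𝟙*𝟙⇒true false c     (+<+ ())

  ≤+𝟙-does* : ∀ {P : Set} (P? : Dec P) {x y c} → 0ℤ ≤ y → (P → x ≤ c) → (¬ P → x ≤ y) →
              x ≤ y + 𝟙 (does P?) * c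
  ≤+𝟙-does* (yes p) {x} {y} {c} 0≤y x≤c _ =
    ≤-trans (x≤c p) (subst₂ _≤_ (+-identityˡ c) (cong (_+_ y) (sym (*-identityˡ c))) (+-monoˡ-≤ c 0≤y))
  ≤+𝟙-does* (no ¬p) {x} {y} {c} _ _ x≤y = subst (x ≤_) (sym (+-identityʳ y)) (x≤y ¬p)

module CauchySchwarz where

  open import Data.Nat as ℕ using (ℕ)
  open import Data.Integer using (ℤ; +_; -[1+_]; 0ℤ; 1ℤ; _+_; _*_; _-_; -_; _≤_; +≤+)
  open import Data.Integer.Properties
  open import Data.Integer.Tactic.RingSolver using (solve-∀)
  open import Data.List using (List)
  open import Relation.Binary.PropositionalEquality
  open FiniteSums

  private
    variable
      X : Set

  0≤i*i : ∀ i → 0ℤ ≤ i * i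
  0≤i*i (+ n)    = subst (0ℤ ≤_) (pos-* n n) (+≤+ ℕ.z≤n)
  0≤i*i -[1+ n ] = +≤+ ℕ.z≤n

  *-monoˡ-≤-0≤ : ∀ {i j k} → 0ℤ ≤ i → j ≤ k → i * j ≤ i * k
  *-monoˡ-≤-0≤ {+ n} _ = *-monoˡ-≤-nonNeg (+ n)

  *-monoʳ-≤-0≤ : ∀ {i j k} → 0ℤ ≤ i → j ≤ k → j * i ≤ k * i
  *-monoʳ-≤-0≤ {i} {j} {k} 0≤i j≤k = subst₂ _≤_ (*-comm i j) (*-comm i k) (*-monoˡ-≤-0≤ 0≤i j≤k)

  0≤i*j : ∀ {i j} → 0ℤ ≤ i → 0ℤ ≤ j → 0ℤ ≤ i * j
  0≤i*j {i} {j} 0≤i 0≤j = subst (_≤ i * j) (*-zeroʳ i) (*-monoˡ-≤-0≤ 0≤i 0≤j)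

  private
    expand-lagrange : ∀ wx wy cx cy → wx * wy * ((cx - cy) * (cx - cy))
                      ≡ wx * (cx * cx) * wy + wx * (wy * (cy * cy)) + (- + 2 * (wx * cx)) * (wy * cy)
    expand-lagrange = solve-∀

    collect-lagrange : ∀ W Q S → Q * W + W * Q + (- + 2 * S) * S ≡ + 2 * (W * Q - S * S)
    collect-lagrange = solve-∀

    expand-affine² : ∀ a b f → (a * f - b) * (a * f - b) ≡ a * a * (f * f) + (- (+ 2 * a * b)) * f + b * b * 1ℤ
    expand-affine² = solve-∀

  cauchy-schwarz : ∀ {X : Set} (xs : List X) (w c : X → ℤ) → (∀ x → 0ℤ ≤ w x) →
    ∑[ x ∈ xs ] (w x * c x) * ∑[ x ∈ xs ] (w x * c x) ≤ ∑[ x ∈ xs ] w x * ∑[ x ∈ xs ] (w x * (c x * c x))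
  cauchy-schwarz {X} xs w c 0≤w = 0≤i-j⇒j≤i (*-cancelˡ-≤-pos 0ℤ (W * Q - S * S) (+ 2)
    (subst (_≤ + 2 * (W * Q - S * S)) (*-zeroʳ (+ 2)) (subst (0ℤ ≤_) lagrange
      (∑-nonNeg xs λ x → ∑-nonNeg xs λ y → 0≤i*j (0≤i*j (0≤w x) (0≤w y)) (0≤i*i (c x - c y))))))
    where
    W S Q : ℤ
    W = ∑[ x ∈ xs ] w x
    S = ∑[ x ∈ xs ] (w x * c x)
    Q = ∑[ x ∈ xs ] (w x * (c x * c x))
    q s : X → ℤ
    q x = w x * (c x * c x)
    s x = w x * c x
    lagrange : ∑[ x ∈ xs ] ∑[ y ∈ xs ] (w x * w y * ((c x - c y) * (c x - c y))) ≡ + 2 * (W * Q - S * S)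
    lagrange = begin
      ∑[ x ∈ xs ] ∑[ y ∈ xs ] (w x * w y * ((c x - c y) * (c x - c y)))
        ≡⟨ ∑-cong xs (λ x → ∑-cong xs (λ y → expand-lagrange (w x) (w y) (c x) (c y))) ⟩
      ∑[ x ∈ xs ] ∑[ y ∈ xs ] (q x * w y + w x * q y + (- + 2 * s x) * s y)
        ≡⟨ ∑-cong xs (λ x → trans (∑-distrib-+ xs _ _)
                                  (cong (_+ ∑[ y ∈ xs ] ((- + 2 * s x) * s y)) (∑-distrib-+ xs _ _))) ⟩
      ∑[ x ∈ xs ] (∑[ y ∈ xs ] (q x * w y) + ∑[ y ∈ xs ] (w x * q y) + ∑[ y ∈ xs ] ((- + 2 * s x) * s y))
        ≡⟨ trans (∑-distrib-+ xs _ _)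
                 (cong (_+ ∑[ x ∈ xs ] ∑[ y ∈ xs ] ((- + 2 * s x) * s y)) (∑-distrib-+ xs _ _)) ⟩
      ∑[ x ∈ xs ] ∑[ y ∈ xs ] (q x * w y) + ∑[ x ∈ xs ] ∑[ y ∈ xs ] (w x * q y)
        + ∑[ x ∈ xs ] ∑[ y ∈ xs ] ((- + 2 * s x) * s y)
        ≡⟨ cong₂ _+_ (cong₂ _+_ (∑-product xs xs q w) (∑-product xs xs w q))
                     (trans (∑-product xs xs (λ x → - + 2 * s x) s)
                            (cong (_* S) (∑-distribˡ-* xs (- + 2) s))) ⟩
      Q * W + W * Q + (- + 2 * S) * S
        ≡⟨ collect-lagrange W Q S ⟩
      + 2 * (W * Q - S * S) ∎
      where open ≡-Reasoning

  cauchy-schwarz-01 : ∀ (xs : List X) (w c : X → ℤ) → (∀ x → 0ℤ ≤ w x) → (∀ x → w x ≤ 1ℤ) →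
    ∑[ x ∈ xs ] (w x * c x) * ∑[ x ∈ xs ] (w x * c x) ≤ ∑[ x ∈ xs ] w x * ∑[ x ∈ xs ] (c x * c x)
  cauchy-schwarz-01 xs w c 0≤w w≤1 = ≤-trans (cauchy-schwarz xs w c 0≤w)
    (*-monoˡ-≤-0≤ (∑-nonNeg xs 0≤w) (∑-mono-≤ xs λ x →
      subst (w x * (c x * c x) ≤_) (*-identityˡ (c x * c x)) (*-monoʳ-≤-0≤ (0≤i*i (c x)) (w≤1 x))))

  ∑-affine² : ∀ (xs : List X) (f : X → ℤ) a b →
    ∑[ x ∈ xs ] ((a * f x - b) * (a * f x - b))
    ≡ a * a * ∑[ x ∈ xs ] (f x * f x) + (- (+ 2 * a * b)) * ∑[ x ∈ xs ] f x + b * b * ∑[ x ∈ xs ] 1ℤ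
  ∑-affine² xs f a b = begin
    ∑[ x ∈ xs ] ((a * f x - b) * (a * f x - b))
      ≡⟨ ∑-cong xs (λ x → expand-affine² a b (f x)) ⟩
    ∑[ x ∈ xs ] (a * a * (f x * f x) + (- (+ 2 * a * b)) * f x + b * b * 1ℤ)
      ≡⟨ trans (∑-distrib-+ xs _ _) (cong (_+ ∑[ x ∈ xs ] (b * b * 1ℤ)) (∑-distrib-+ xs _ _)) ⟩
    ∑[ x ∈ xs ] (a * a * (f x * f x)) + ∑[ x ∈ xs ] ((- (+ 2 * a * b)) * f x) + ∑[ x ∈ xs ] (b * b * 1ℤ)
      ≡⟨ cong₂ _+_ (cong₂ _+_ (∑-distribˡ-* xs (a * a) _) (∑-distribˡ-* xs (- (+ 2 * a * b)) f))
                   (∑-distribˡ-* xs (b * b) (λ _ → 1ℤ)) ⟩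
    a * a * ∑[ x ∈ xs ] (f x * f x) + (- (+ 2 * a * b)) * ∑[ x ∈ xs ] f x + b * b * ∑[ x ∈ xs ] 1ℤ ∎
    where open ≡-Reasoning

module Enumerations where

  open import Data.Nat using (ℕ)
  open import Data.Integer using (ℤ; +_; 1ℤ; _*_)
  open import Data.Integer.Properties using (*-identityʳ)
  open import Data.List using (List; allFin; cartesianProduct; length)
  open import Data.List.Properties using (length-tabulate)
  open import Data.List.Membership.Propositional using (_∈_)
  open import Data.List.Membership.Propositional.Properties using (∈-allFin; ∈-cartesianProduct⁺)
  open import Data.List.Relation.Unary.Unique.Propositional using (Unique)
  open import Data.List.Relation.Unary.Unique.Propositional.Properties using (allFin⁺; cartesianProduct⁺)
  open import Data.Product using (_×_; _,_; proj₁; proj₂)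
  open import Function using (id)
  open import Relation.Binary.PropositionalEquality
  open import Defs using (Pt; Motion)
  open FiniteSums

  points : ∀ N → List (Pt N)
  points N = cartesianProduct (allFin N) (allFin N)

  motions : ∀ N → List (Motion N)
  motions N = cartesianProduct (allFin N) (cartesianProduct (allFin N) (points N))

  pairs : ∀ N → List (Pt N × Pt N)
  pairs N = cartesianProduct (points N) (points N)

  points-unique : ∀ N → Unique (points N)
  points-unique N = cartesianProduct⁺ (allFin⁺ N) (allFin⁺ N)

  ∈-points : ∀ {N} (x : Pt N) → x ∈ points N
  ∈-points (i , j) = ∈-cartesianProduct⁺ (∈-allFin i) (∈-allFin j)

  module _ {N : ℕ} where

    ∑-motions : ∀ (f : Motion N → ℤ) →
      ∑[ m ∈ motions N ] f m ≡ ∑[ g ∈ points N ] ∑[ z ∈ points N ] f (proj₁ g , proj₂ g , z)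
    ∑-motions f = begin
      ∑[ m ∈ motions N ] f m
        ≡⟨ ∑-cartesianProduct (allFin N) _ f ⟩
      ∑[ a ∈ allFin N ] ∑[ bz ∈ cartesianProduct (allFin N) (points N) ] f (a , bz)
        ≡⟨ ∑-cong (allFin N) (λ a → ∑-cartesianProduct (allFin N) (points N) (λ bz → f (a , bz))) ⟩
      ∑[ a ∈ allFin N ] ∑[ b ∈ allFin N ] ∑[ z ∈ points N ] f (a , b , z)
        ≡⟨ ∑-cartesianProduct (allFin N) (allFin N) (λ g → ∑[ z ∈ points N ] f (proj₁ g , proj₂ g , z)) ⟨
      ∑[ g ∈ points N ] ∑[ z ∈ points N ] f (proj₁ g , proj₂ g , z) ∎
      where open ≡-Reasoning

    ∑-pairs : ∀ (f : Pt N → Pt N → ℤ) →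
      ∑[ xy ∈ pairs N ] f (proj₁ xy) (proj₂ xy) ≡ ∑[ x ∈ points N ] ∑[ y ∈ points N ] f x y
    ∑-pairs f = ∑-cartesianProduct (points N) (points N) (λ xy → f (proj₁ xy) (proj₂ xy))

    ∑[points]-1 : ∑[ x ∈ points N ] 1ℤ ≡ + N * + N
    ∑[points]-1 = begin
      ∑[ x ∈ points N ] 1ℤ                    ≡⟨ ∑-cartesianProduct (allFin N) (allFin N) (λ _ → 1ℤ) ⟩
      ∑[ i ∈ allFin N ] ∑[ j ∈ allFin N ] 1ℤ  ≡⟨ ∑-cong (allFin N) (λ _ → ∑[allFin]-1 N) ⟩
      ∑[ i ∈ allFin N ] (+ N)                 ≡⟨ ∑-const (allFin N) (+ N) ⟩
      + N * + length (allFin N)               ≡⟨ cong (λ n → + N * + n) (length-tabulate id) ⟩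
      + N * + N                               ∎
      where open ≡-Reasoning

    ∑[pairs]-1 : ∑[ xy ∈ pairs N ] 1ℤ ≡ (+ N * + N) * (+ N * + N)
    ∑[pairs]-1 = begin
      ∑[ xy ∈ pairs N ] 1ℤ                    ≡⟨ ∑-pairs (λ _ _ → 1ℤ) ⟩
      ∑[ x ∈ points N ] ∑[ y ∈ points N ] 1ℤ  ≡⟨ ∑-cong (points N) (λ _ → ∑[points]-1) ⟩
      ∑[ x ∈ points N ] (+ N * + N)           ≡⟨ ∑-cong (points N) (λ _ → *-identityʳ (+ N * + N)) ⟨
      ∑[ x ∈ points N ] ((+ N * + N) * 1ℤ)    ≡⟨ ∑-distribˡ-* (points N) (+ N * + N) (λ _ → 1ℤ) ⟩
      (+ N * + N) * ∑[ x ∈ points N ] 1ℤ      ≡⟨ cong ((+ N * + N) *_) ∑[points]-1 ⟩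
      (+ N * + N) * (+ N * + N)               ∎
      where open ≡-Reasoning

module Congruences where

  open import Data.Nat as ℕ using (ℕ; zero; suc; NonZero; _^_)
  import Data.Nat.Properties as ℕ
  import Data.Nat.Divisibility as ℕ
  open import Data.Nat.Primality using (Prime; euclidsLemma; prime⇒nonZero)
  open import Data.Nat.Tactic.RingSolver renaming (solve-∀ to ℕ-solve-∀)
  open import Data.Integer using (ℤ; +_; _+_; _*_; _-_; -_; ∣_∣; _%ℕ_; _/ℕ_)
  open import Data.Integer.Properties
  open import Data.Integer.DivMod using (n%ℕd<d; a≡a%ℕn+[a/ℕn]*n)
  open import Data.Integer.Divisibility.Signed
  open import Data.Integer.Tactic.RingSolver using (solve-∀)
  open import Data.Fin using (Fin; toℕ; fromℕ<)
  open import Data.Fin.Properties using (toℕ-injective; toℕ<n; toℕ-fromℕ<)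
  open import Data.Sum using (_⊎_; inj₁; inj₂)
  open import Data.Bool using (true)
  open import Function using (_$_)
  open import Relation.Binary.PropositionalEquality
  open import Relation.Nullary using (Dec; does; yes; ¬_; contradiction)
  open import Relation.Nullary.Decidable using (dec-true)
  open import Defs using (congB; _≡_[mod_])

  -- A record rather than a synonym for + n ∣ a - b, so that Agda can recover a and b from the
  -- type of a congruence instead of having to invert ℤ arithmetic.
  infix 4 _≡_[modℤ_]
  record _≡_[modℤ_] (a b : ℤ) (n : ℕ) : Set where
    constructor ≡modℤ
    field difference-divisible : + n ∣ a - b
  open _≡_[modℤ_] public

  ∣m-n∣≡∣[+m]-[+n]∣ : ∀ m n → ℕ.∣ m - n ∣ ≡ ∣ + m - + n ∣
  ∣m-n∣≡∣[+m]-[+n]∣ m n with ℕ.≤-total m n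
  ... | inj₁ m≤n = trans (ℕ.m≤n⇒∣m-n∣≡n∸m m≤n) (sym (trans (cong ∣_∣ (m-n≡m⊖n m n)) (∣⊖∣-≤ m≤n)))
  ... | inj₂ n≤m = trans (ℕ.m≤n⇒∣n-m∣≡n∸m n≤m)
                         (sym (trans (cong ∣_∣ (m-n≡m⊖n m n)) (trans (∣m⊖n∣≡∣n⊖m∣ m n) (∣⊖∣-≤ n≤m))))

  does⇒ : ∀ {A : Set} (a? : Dec A) → does a? ≡ true → A
  does⇒ (yes a) _ = a

  ≡mod⇒≡modℤ : ∀ {n u v} → u ≡ v [mod n ] → + u ≡ + v [modℤ n ]
  ≡mod⇒≡modℤ {n} {u} {v} u≡v = ≡modℤ (∣ᵤ⇒∣ (subst (n ℕ.∣_) (∣m-n∣≡∣[+m]-[+n]∣ u v) u≡v))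

  congB⇒≡modℤ : ∀ n u v → congB n u v ≡ true → + u ≡ + v [modℤ n ]
  congB⇒≡modℤ n u v holds = ≡mod⇒≡modℤ (does⇒ (n ℕ.∣? ℕ.∣ u - v ∣) holds)

  ≡modℤ⇒congB : ∀ n u v → + u ≡ + v [modℤ n ] → congB n u v ≡ true
  ≡modℤ⇒congB n u v (≡modℤ n∣u-v) =
    dec-true (n ℕ.∣? ℕ.∣ u - v ∣) (subst (n ℕ.∣_) (sym (∣m-n∣≡∣[+m]-[+n]∣ u v)) (∣⇒∣ᵤ n∣u-v))

  module _ {n : ℕ} where

    modℤ-sym : ∀ {a b} → a ≡ b [modℤ n ] → b ≡ a [modℤ n ]
    modℤ-sym {a} {b} (≡modℤ n∣a-b) = ≡modℤ (subst (+ n ∣_) (neg-minus a b) (∣m⇒∣-m n∣a-b))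
      where
      neg-minus : ∀ a b → - (a - b) ≡ b - a
      neg-minus = solve-∀

    modℤ-trans : ∀ {a b c} → a ≡ b [modℤ n ] → b ≡ c [modℤ n ] → a ≡ c [modℤ n ]
    modℤ-trans {a} {b} {c} (≡modℤ n∣a-b) (≡modℤ n∣b-c) =
      ≡modℤ (subst (+ n ∣_) (+-minus-telescope a b c) (∣m∣n⇒∣m+n n∣a-b n∣b-c))

    modℤ-divisor : ∀ {m a b} → m ℕ.∣ n → a ≡ b [modℤ n ] → a ≡ b [modℤ m ]
    modℤ-divisor m∣n (≡modℤ n∣a-b) = ≡modℤ (∣-trans (∣ᵤ⇒∣ m∣n) n∣a-b)

    modℤ-by-difference : ∀ {a b c d} → a - b ≡ c - d → a ≡ b [modℤ n ] → c ≡ d [modℤ n ]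
    modℤ-by-difference a-b≡c-d (≡modℤ n∣a-b) = ≡modℤ (subst (+ n ∣_) a-b≡c-d n∣a-b)

    ≡modℤ⇒toℕ-injective : ∀ (i j : Fin n) → + toℕ i ≡ + toℕ j [modℤ n ] → i ≡ j
    ≡modℤ⇒toℕ-injective i j (≡modℤ n∣i-j) =
      toℕ-injective (ℕ.∣m-n∣≡0⇒m≡n (multiple-below-n⇒0 distance<n n∣distance))
      where
      distance = ℕ.∣ toℕ i - toℕ j ∣
      n∣distance : n ℕ.∣ distance
      n∣distance = subst (n ℕ.∣_) (sym (∣m-n∣≡∣[+m]-[+n]∣ (toℕ i) (toℕ j))) (∣⇒∣ᵤ n∣i-j)
      distance<n : distance ℕ.< n
      distance<n = ℕ.≤-<-trans (ℕ.∣m-n∣≤m⊔n (toℕ i) (toℕ j)) (ℕ.⊔-lub (toℕ<n i) (toℕ<n j))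
      multiple-below-n⇒0 : ∀ {d} → d ℕ.< n → n ℕ.∣ d → d ≡ 0
      multiple-below-n⇒0 {zero}  _   _   = refl
      multiple-below-n⇒0 {suc d} d<n n∣d = contradiction (ℕ.∣⇒≤ n∣d) (ℕ.<⇒≱ d<n)

    module _ {{_ : NonZero n}} where

      %ℕ-≡modℤ : ∀ v → + (v %ℕ n) ≡ v [modℤ n ]
      %ℕ-≡modℤ v = ≡modℤ $ divides (- (v /ℕ n)) $ begin
        + (v %ℕ n) - v                             ≡⟨ cong (λ v′ → + (v %ℕ n) - v′) (a≡a%ℕn+[a/ℕn]*n v n) ⟩
        + (v %ℕ n) - (+ (v %ℕ n) + (v /ℕ n) * + n) ≡⟨ cancel (+ (v %ℕ n)) (v /ℕ n) (+ n) ⟩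
        - (v /ℕ n) * + n                           ∎
        where
        open ≡-Reasoning
        cancel : ∀ r q n → r - (r + q * n) ≡ - q * n
        cancel = solve-∀

      residue : ℤ → Fin n
      residue v = fromℕ< (n%ℕd<d v n)

      residue-≡modℤ : ∀ v → + toℕ (residue v) ≡ v [modℤ n ]
      residue-≡modℤ v = subst (λ r → + r ≡ v [modℤ n ]) (sym (toℕ-fromℕ< (n%ℕd<d v n))) (%ℕ-≡modℤ v)

  module _ {p : ℕ} (prime : Prime p) where

    private
      instance
        p≢0 : NonZero p
        p≢0 = prime⇒nonZero prime

      prime-power-cancelℕ : ∀ {c} → ¬ p ℕ.∣ c → ∀ k {u} → p ^ k ℕ.∣ c ℕ.* u → p ^ k ℕ.∣ u
      prime-power-cancelℕ p∤c zero    {u} _ = ℕ.1∣ u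
      prime-power-cancelℕ {c} p∤c (suc k) {u} p^[1+k]∣cu
        with euclidsLemma c u prime (ℕ.∣-trans (ℕ.m∣m*n (p ^ k)) p^[1+k]∣cu)
      ... | inj₁ p∣c = contradiction p∣c p∤c
      ... | inj₂ (ℕ.divides u′ refl) =
        subst (ℕ._∣ u′ ℕ.* p) (ℕ.*-comm (p ^ k) p) (ℕ.*-monoˡ-∣ p p^k∣u′)
        where
        shuffle : ∀ c u′ p → c ℕ.* (u′ ℕ.* p) ≡ p ℕ.* (c ℕ.* u′)
        shuffle = ℕ-solve-∀
        p^k∣u′ : p ^ k ℕ.∣ u′
        p^k∣u′ = prime-power-cancelℕ p∤c k
          (ℕ.*-cancelˡ-∣ p (subst (p ^ suc k ℕ.∣_) (shuffle c u′ p) p^[1+k]∣cu))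

    prime-power-cancel : ∀ k {c u} → ¬ + p ∣ c → + (p ^ k) ∣ c * u → + (p ^ k) ∣ u
    prime-power-cancel k {c} {u} p∤c p^k∣cu = ∣ᵤ⇒∣
      (prime-power-cancelℕ (λ p∣c → p∤c (∣ᵤ⇒∣ p∣c)) k (subst (p ^ k ℕ.∣_) (abs-* c u) (∣⇒∣ᵤ p^k∣cu)))

    euclidsLemmaᶻ : ∀ i j → + p ∣ i * j → (+ p ∣ i) ⊎ (+ p ∣ j)
    euclidsLemmaᶻ i j p∣ij with euclidsLemma ∣ i ∣ ∣ j ∣ prime (subst (p ℕ.∣_) (abs-* i j) (∣⇒∣ᵤ p∣ij))
    ... | inj₁ p∣i = inj₁ (∣ᵤ⇒∣ p∣i)
    ... | inj₂ p∣j = inj₂ (∣ᵤ⇒∣ p∣j)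

    ∣-square⇒∣ : ∀ i → + p ∣ i * i → + p ∣ i
    ∣-square⇒∣ i p∣i² with euclidsLemmaᶻ i i p∣i²
    ... | inj₁ p∣i = p∣i
    ... | inj₂ p∣i = p∣i

  odd⇒∤2 : ∀ {p} → 2 ℕ.< p → ¬ + p ∣ + 2
  odd⇒∤2 2<p p∣2 = ℕ.<⇒≱ 2<p (ℕ.∣⇒≤ (∣⇒∣ᵤ p∣2))

module RotationAlgebra where

  open import Data.Nat as ℕ using (ℕ; _^_)
  open import Data.Nat.Primality using (Prime)
  open import Data.Integer using (ℤ; +_; 1ℤ; _+_; _*_; _-_; -_)
  open import Data.Integer.Divisibility.Signed
  open import Data.Integer.Tactic.RingSolver using (solve-∀)
  open import Data.Product using (_×_; _,_)
  open import Data.Sum using ([_,_]′)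
  open import Function using (id; _$_)
  open import Relation.Binary.PropositionalEquality
  open import Relation.Nullary using (¬_; contradiction)
  open Congruences

  -- For rotations g = (a, b) and g′ = (a′, b′), i.e. [[a, −b], [b, a]], the relative rotation
  -- g⁻¹ g′ is (dot, cross).
  dot cross : ℤ → ℤ → ℤ → ℤ → ℤ
  dot   a b a′ b′ = a * a′ + b * b′
  cross a b a′ b′ = a * b′ - b * a′

  sqDist : ℤ → ℤ → ℤ → ℤ → ℤ
  sqDist a b a′ b′ = (a - a′) * (a - a′) + (b - b′) * (b - b′)

  private
    sqDist-via-dot : ∀ a b a′ b′ →
      (a - a′) * (a - a′) + (b - b′) * (b - b′) - (a * a + b * b - 1ℤ) - (a′ * a′ + b′ * b′ - 1ℤ)
      ≡ + 2 * (1ℤ - (a * a′ + b * b′))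
    sqDist-via-dot = solve-∀

    cross²-via-dot : ∀ a b a′ b′ →
      (1ℤ + (a * a′ + b * b′)) * (1ℤ - (a * a′ + b * b′))
        + ((a * a + b * b - 1ℤ) * (a′ * a′ + b′ * b′ - 1ℤ) + (a * a + b * b - 1ℤ) + (a′ * a′ + b′ * b′ - 1ℤ))
      ≡ (a * b′ - b * a′) * (a * b′ - b * a′)
    cross²-via-dot = solve-∀

    dot-difference : ∀ a b a₁ b₁ a₂ b₂ →
      (a * a + b * b - 1ℤ) * (a₁ * a₁ + b₁ * b₁ - 1ℤ) + (a₁ * a₁ + b₁ * b₁ - 1ℤ)
        - ((a * a + b * b - 1ℤ) * (a₂ * a₂ + b₂ * b₂ - 1ℤ) + (a₂ * a₂ + b₂ * b₂ - 1ℤ))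
        - ((a * b₁ - b * a₁) + (a * b₂ - b * a₂)) * ((a * b₁ - b * a₁) - (a * b₂ - b * a₂))
      ≡ ((a * a₁ + b * b₁) + (a * a₂ + b * b₂)) * ((a * a₁ + b * b₁) - (a * a₂ + b * b₂))
    dot-difference = solve-∀

    sum-with-defects : ∀ c₁ c₂ → (c₁ + c₂) + (1ℤ - c₁) + (1ℤ - c₂) ≡ + 2
    sum-with-defects = solve-∀

    rotate-back₁ : ∀ a b a₁ b₁ a₂ b₂ →
      a * ((a * a₁ + b * b₁) - (a * a₂ + b * b₂)) - b * ((a * b₁ - b * a₁) - (a * b₂ - b * a₂))
        - (a₁ - a₂) * (a * a + b * b - 1ℤ)
      ≡ a₁ - a₂
    rotate-back₁ = solve-∀

    rotate-back₂ : ∀ a b a₁ b₁ a₂ b₂ →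
      b * ((a * a₁ + b * b₁) - (a * a₂ + b * b₂)) + a * ((a * b₁ - b * a₁) - (a * b₂ - b * a₂))
        - (b₁ - b₂) * (a * a + b * b - 1ℤ)
      ≡ b₁ - b₂
    rotate-back₂ = solve-∀

    conjugate-re : ∀ α β u v → α * (α * u - β * v) + β * (β * u + α * v) ≡ (α * α + β * β) * u
    conjugate-re = solve-∀

    conjugate-im : ∀ α β u v → - β * (α * u - β * v) + α * (β * u + α * v) ≡ (α * α + β * β) * v
    conjugate-im = solve-∀

  -- In the proofs below, facts about dot, cross and sqDist are restated (primed names) with the
  -- definitions unfolded: leaving the unifier to see through them inside ℤ arithmetic is very slow.

  module _ {p : ℕ} (prime : Prime p) where

    unit-norm⇒cancel : ∀ k α β u v → ¬ + p ∣ α * α + β * β →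
      + (p ^ k) ∣ α * u - β * v → + (p ^ k) ∣ β * u + α * v → + (p ^ k) ∣ u × + (p ^ k) ∣ v
    unit-norm⇒cancel k α β u v p∤norm q∣re q∣im =
      prime-power-cancel prime k p∤norm
        (subst (+ (p ^ k) ∣_) (conjugate-re α β u v) (∣m∣n⇒∣m+n (∣n⇒∣m*n α q∣re) (∣n⇒∣m*n β q∣im))) ,
      prime-power-cancel prime k p∤norm
        (subst (+ (p ^ k) ∣_) (conjugate-im α β u v) (∣m∣n⇒∣m+n (∣n⇒∣m*n (- β) q∣re) (∣n⇒∣m*n α q∣im)))

    module _ (2<p : 2 ℕ.< p) where

      close⇒relative≡1 : ∀ {a b a′ b′} →
        a * a + b * b ≡ 1ℤ [modℤ p ] → a′ * a′ + b′ * b′ ≡ 1ℤ [modℤ p ] → + p ∣ sqDist a b a′ b′ →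
        + p ∣ 1ℤ - dot a b a′ b′ × + p ∣ cross a b a′ b′
      close⇒relative≡1 {a} {b} {a′} {b′} (≡modℤ unit) (≡modℤ unit′) close = p∣1-dot , p∣cross
        where
        close′ : + p ∣ (a - a′) * (a - a′) + (b - b′) * (b - b′)
        close′ = close
        p∣1-dot : + p ∣ 1ℤ - dot a b a′ b′
        p∣1-dot = [ (λ p∣2 → contradiction p∣2 (odd⇒∤2 2<p)) , id ]′
          (euclidsLemmaᶻ prime (+ 2) (1ℤ - dot a b a′ b′)
            (subst (+ p ∣_) (sqDist-via-dot a b a′ b′) (∣m∣n⇒∣m-n (∣m∣n⇒∣m-n close′ unit) unit′)))
        p∣1-dot′ : + p ∣ 1ℤ - (a * a′ + b * b′)
        p∣1-dot′ = p∣1-dot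
        p∣cross : + p ∣ cross a b a′ b′
        p∣cross = ∣-square⇒∣ prime (cross a b a′ b′) (subst (+ p ∣_) (cross²-via-dot a b a′ b′)
          (∣m∣n⇒∣m+n (∣n⇒∣m*n (1ℤ + (a * a′ + b * b′)) p∣1-dot′)
                     (∣m∣n⇒∣m+n (∣m∣n⇒∣m+n (∣n⇒∣m*n (a * a + b * b - 1ℤ) unit′) unit) unit′)))

      -- dotᵢ² + crossᵢ² ≡ 1 and dotᵢ ≡ 1 (mod p), so equal cross terms give dot₁² ≡ dot₂² with
      -- dot₁ + dot₂ ≡ 2 prime to p, hence dot₁ ≡ dot₂ (mod p^k); then gᵢ ≡ g · (dotᵢ, crossᵢ).
      close-and-same-cross⇒≡ : ∀ k {a b a₁ b₁ a₂ b₂} → let q = p ^ k in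
        a * a + b * b ≡ 1ℤ [modℤ q ] → a₁ * a₁ + b₁ * b₁ ≡ 1ℤ [modℤ q ] → a₂ * a₂ + b₂ * b₂ ≡ 1ℤ [modℤ q ] →
        + p ∣ 1ℤ - dot a b a₁ b₁ → + p ∣ 1ℤ - dot a b a₂ b₂ →
        cross a b a₁ b₁ ≡ cross a b a₂ b₂ [modℤ q ] →
        a₁ ≡ a₂ [modℤ q ] × b₁ ≡ b₂ [modℤ q ]
      close-and-same-cross⇒≡ k {a} {b} {a₁} {b₁} {a₂} {b₂} (≡modℤ unit) (≡modℤ unit₁) (≡modℤ unit₂)
                               p∣1-dot₁ p∣1-dot₂ (≡modℤ same-cross) = a₁≡a₂ , b₁≡b₂
        where
        q = p ^ k
        X = a * a + b * b - 1ℤ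
        c₁ = dot a b a₁ b₁
        c₂ = dot a b a₂ b₂
        same-cross′ : + q ∣ (a * b₁ - b * a₁) - (a * b₂ - b * a₂)
        same-cross′ = same-cross
        q∣[c₁+c₂][c₁-c₂] : + q ∣ ((a * a₁ + b * b₁) + (a * a₂ + b * b₂)) * ((a * a₁ + b * b₁) - (a * a₂ + b * b₂))
        q∣[c₁+c₂][c₁-c₂] = subst (+ q ∣_) (dot-difference a b a₁ b₁ a₂ b₂)
          (∣m∣n⇒∣m-n (∣m∣n⇒∣m-n (∣m∣n⇒∣m+n (∣n⇒∣m*n X unit₁) unit₁) (∣m∣n⇒∣m+n (∣n⇒∣m*n X unit₂) unit₂))
                     (∣n⇒∣m*n ((a * b₁ - b * a₁) + (a * b₂ - b * a₂)) same-cross′))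
        p∤c₁+c₂ : ¬ + p ∣ c₁ + c₂
        p∤c₁+c₂ p∣c₁+c₂ = odd⇒∤2 2<p
          (subst (+ p ∣_) (sum-with-defects c₁ c₂) (∣m∣n⇒∣m+n (∣m∣n⇒∣m+n p∣c₁+c₂ p∣1-dot₁) p∣1-dot₂))
        c₁≡c₂ : + q ∣ (a * a₁ + b * b₁) - (a * a₂ + b * b₂)
        c₁≡c₂ = prime-power-cancel prime k p∤c₁+c₂ q∣[c₁+c₂][c₁-c₂]
        a₁≡a₂ : a₁ ≡ a₂ [modℤ q ]
        a₁≡a₂ = ≡modℤ $ subst (+ q ∣_) (rotate-back₁ a b a₁ b₁ a₂ b₂)
          (∣m∣n⇒∣m-n (∣m∣n⇒∣m-n (∣n⇒∣m*n a c₁≡c₂) (∣n⇒∣m*n b same-cross′)) (∣n⇒∣m*n (a₁ - a₂) unit))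
        b₁≡b₂ : b₁ ≡ b₂ [modℤ q ]
        b₁≡b₂ = ≡modℤ $ subst (+ q ∣_) (rotate-back₂ a b a₁ b₁ a₂ b₂)
          (∣m∣n⇒∣m-n (∣m∣n⇒∣m+n (∣n⇒∣m*n b c₁≡c₂) (∣n⇒∣m*n a same-cross′)) (∣n⇒∣m*n (b₁ - b₂) unit))

module RigidMotions where

  open import Data.Nat as ℕ using (ℕ; NonZero; _^_)
  import Data.Nat.Divisibility as ℕ
  open import Data.Nat.Primality using (Prime)
  open import Data.Integer using (ℤ; +_; 1ℤ; _+_; _*_; _-_)
  open import Data.Integer.Properties using (pos-+; pos-*)
  open import Data.Integer.Divisibility.Signed
  open import Data.Integer.Tactic.RingSolver using (solve-∀)
  open import Data.Fin using (Fin; toℕ)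
  open import Data.Bool using (true; _∧_)
  open import Data.Product using (_×_; _,_; proj₁; proj₂)
  open import Function.Bundles using (_⇔_; mk⇔; Equivalence)
  open import Relation.Binary.PropositionalEquality
  open import Relation.Nullary using (Dec; ¬_)
  open import Defs
  open Congruences
  open RotationAlgebra

  ∧≡true⇒ : ∀ {b c} → b ∧ c ≡ true → b ≡ true × c ≡ true
  ∧≡true⇒ {true} {true} _ = refl , refl

  ∧-intro : ∀ {b c} → b ≡ true → c ≡ true → b ∧ c ≡ true
  ∧-intro refl refl = refl

  private
    ⟦m*n+o⟧ : ∀ m n o → + (m ℕ.* n ℕ.+ o) ≡ + m * + n + + o
    ⟦m*n+o⟧ m n o = trans (pos-+ (m ℕ.* n) o) (cong (_+ + o) (pos-* m n))

    ⟦m+n*o⟧ : ∀ m n o → + (m ℕ.+ n ℕ.* o) ≡ + m + + n * + o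
    ⟦m+n*o⟧ m n o = trans (pos-+ m (n ℕ.* o)) (cong (_+_ (+ m)) (pos-* n o))

    ⟦m*n+o*p+q⟧ : ∀ m n o p q → + (m ℕ.* n ℕ.+ o ℕ.* p ℕ.+ q) ≡ + m * + n + + o * + p + + q
    ⟦m*n+o*p+q⟧ m n o p q = trans (pos-+ (m ℕ.* n ℕ.+ o ℕ.* p) q)
      (cong (_+ + q) (trans (⟦m*n+o⟧ m n (o ℕ.* p)) (cong (_+_ (+ m * + n)) (pos-* o p))))

    move-term : ∀ a y z x b y′ → (x + b * y′) - (a * y + z) ≡ x - (a * y - b * y′ + z)
    move-term = solve-∀

    cancel-translation : ∀ s z z′ → (s + z) - (s + z′) ≡ z - z′
    cancel-translation = solve-∀

    swap-differences : ∀ p q r s → (p - q) - (r - s) ≡ (p - r) - (q - s)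
    swap-differences = solve-∀

    image₁-difference : ∀ a b y₁ y₂ y₁′ y₂′ z → (a * y₁ - b * y₂ + z) - (a * y₁′ - b * y₂′ + z)
                        ≡ a * (y₁ - y₁′) - b * (y₂ - y₂′)
    image₁-difference = solve-∀

    image₂-difference : ∀ a b y₁ y₂ y₁′ y₂′ z → (b * y₁ + a * y₂ + z) - (b * y₁′ + a * y₂′ + z)
                        ≡ b * (y₁ - y₁′) + a * (y₂ - y₂′)
    image₂-difference = solve-∀

    collect₁ : ∀ a b a′ b′ u v → (a * u - b * v) - (a′ * u - b′ * v) ≡ (a - a′) * u - (b - b′) * v
    collect₁ = solve-∀

    collect₂ : ∀ a b a′ b′ u v → (b * u + a * v) - (b′ * u + a′ * v) ≡ (b - b′) * u + (a - a′) * v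
    collect₂ = solve-∀

  -- The incidence lemmas take their motions and points explicitly: incidentB computes on them, so
  -- they cannot be inferred from the type of an incidence proof.
  module _ {N : ℕ} where

    ⟦_⟧ : Fin N → ℤ
    ⟦ i ⟧ = + toℕ i

    isRot? : ∀ (a b : Fin N) → Dec (IsRot N a b)
    isRot? a b = N ℕ.∣? _

    IsRot⇒unit : ∀ (a b : Fin N) → IsRot N a b → ⟦ a ⟧ * ⟦ a ⟧ + ⟦ b ⟧ * ⟦ b ⟧ ≡ 1ℤ [modℤ N ]
    IsRot⇒unit a b rot = subst (_≡ 1ℤ [modℤ N ]) cast (≡mod⇒≡modℤ rot)
      where
      cast : + (toℕ a ℕ.* toℕ a ℕ.+ toℕ b ℕ.* toℕ b) ≡ ⟦ a ⟧ * ⟦ a ⟧ + ⟦ b ⟧ * ⟦ b ⟧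
      cast = trans (pos-+ (toℕ a ℕ.* toℕ a) _) (cong₂ _+_ (pos-* (toℕ a) (toℕ a)) (pos-* (toℕ b) (toℕ b)))

    image₁ image₂ : Motion N → Pt N → ℤ
    image₁ (a , b , z₁ , z₂) (y₁ , y₂) = ⟦ a ⟧ * ⟦ y₁ ⟧ - ⟦ b ⟧ * ⟦ y₂ ⟧ + ⟦ z₁ ⟧
    image₂ (a , b , z₁ , z₂) (y₁ , y₂) = ⟦ b ⟧ * ⟦ y₁ ⟧ + ⟦ a ⟧ * ⟦ y₂ ⟧ + ⟦ z₂ ⟧

    Sends : Motion N → Pt N → Pt N → Set
    Sends m y (x₁ , x₂) = ⟦ x₁ ⟧ ≡ image₁ m y [modℤ N ] × ⟦ x₂ ⟧ ≡ image₂ m y [modℤ N ]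

    Pt-≡modℤ⇒≡ : ∀ {x₁ x₂ x₁′ x₂′ : Fin N} → ⟦ x₁ ⟧ ≡ ⟦ x₁′ ⟧ [modℤ N ] → ⟦ x₂ ⟧ ≡ ⟦ x₂′ ⟧ [modℤ N ] →
                 (x₁ , x₂) ≡ (x₁′ , x₂′)
    Pt-≡modℤ⇒≡ eq₁ eq₂ = cong₂ _,_ (≡modℤ⇒toℕ-injective _ _ eq₁) (≡modℤ⇒toℕ-injective _ _ eq₂)

    incidentB⇔Sends : ∀ m x y → incidentB N m x y ≡ true ⇔ Sends m y x
    incidentB⇔Sends (a , b , z₁ , z₂) (x₁ , x₂) (y₁ , y₂) = mk⇔
      (λ incident → let (first , second) = ∧≡true⇒ {congB N u₁ v₁} incident in
        modℤ-by-difference (move-term ⟦ a ⟧ ⟦ y₁ ⟧ ⟦ z₁ ⟧ ⟦ x₁ ⟧ ⟦ b ⟧ ⟦ y₂ ⟧)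
          (modℤ-sym (subst₂ _≡_[modℤ N ] cast₁ cast₁′ (congB⇒≡modℤ N u₁ v₁ first))) ,
        modℤ-sym (subst (_≡ ⟦ x₂ ⟧ [modℤ N ]) cast₂ (congB⇒≡modℤ N u₂ (toℕ x₂) second)))
      (λ (sends₁ , sends₂) → ∧-intro
        (≡modℤ⇒congB N u₁ v₁ (subst₂ _≡_[modℤ N ] (sym cast₁) (sym cast₁′) (modℤ-sym
          (modℤ-by-difference (sym (move-term ⟦ a ⟧ ⟦ y₁ ⟧ ⟦ z₁ ⟧ ⟦ x₁ ⟧ ⟦ b ⟧ ⟦ y₂ ⟧)) sends₁))))
        (≡modℤ⇒congB N u₂ (toℕ x₂) (subst (_≡ ⟦ x₂ ⟧ [modℤ N ]) (sym cast₂) (modℤ-sym sends₂))))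
      where
      u₁ = toℕ a ℕ.* toℕ y₁ ℕ.+ toℕ z₁
      v₁ = toℕ x₁ ℕ.+ toℕ b ℕ.* toℕ y₂
      u₂ = toℕ b ℕ.* toℕ y₁ ℕ.+ toℕ a ℕ.* toℕ y₂ ℕ.+ toℕ z₂
      cast₁  = ⟦m*n+o⟧ (toℕ a) (toℕ y₁) (toℕ z₁)
      cast₁′ = ⟦m+n*o⟧ (toℕ x₁) (toℕ b) (toℕ y₂)
      cast₂  = ⟦m*n+o*p+q⟧ (toℕ b) (toℕ y₁) (toℕ a) (toℕ y₂) (toℕ z₂)

    incidentB-common : ∀ m m′ x y → incidentB N m x y ≡ true → incidentB N m′ x y ≡ true →
      image₁ m y ≡ image₁ m′ y [modℤ N ] × image₂ m y ≡ image₂ m′ y [modℤ N ]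
    incidentB-common m m′ x y m·y≡x m′·y≡x =
      modℤ-trans (modℤ-sym (proj₁ m·y)) (proj₁ m′·y) , modℤ-trans (modℤ-sym (proj₂ m·y)) (proj₂ m′·y)
      where
      m·y  = Equivalence.to (incidentB⇔Sends m x y) m·y≡x
      m′·y = Equivalence.to (incidentB⇔Sends m′ x y) m′·y≡x

    incidentB-functional : ∀ m y x x′ → incidentB N m x y ≡ true → incidentB N m x′ y ≡ true → x ≡ x′
    incidentB-functional m y x x′ m·y≡x m·y≡x′ =
      Pt-≡modℤ⇒≡ (modℤ-trans (proj₁ m·y) (modℤ-sym (proj₁ m·y′))) (modℤ-trans (proj₂ m·y) (modℤ-sym (proj₂ m·y′)))
      where
      m·y  = Equivalence.to (incidentB⇔Sends m x y) m·y≡x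
      m·y′ = Equivalence.to (incidentB⇔Sends m x′ y) m·y≡x′

    incidentB-translation : ∀ a b z z′ x y →
      incidentB N (a , b , z) x y ≡ true → incidentB N (a , b , z′) x y ≡ true → z ≡ z′
    incidentB-translation a b (z₁ , z₂) (z₁′ , z₂′) x (y₁ , y₂) m·y≡x m′·y≡x =
      Pt-≡modℤ⇒≡ (modℤ-by-difference (cancel-translation s₁ ⟦ z₁ ⟧ ⟦ z₁′ ⟧) images₁)
                 (modℤ-by-difference (cancel-translation s₂ ⟦ z₂ ⟧ ⟦ z₂′ ⟧) images₂)
      where
      s₁ = ⟦ a ⟧ * ⟦ y₁ ⟧ - ⟦ b ⟧ * ⟦ y₂ ⟧
      s₂ = ⟦ b ⟧ * ⟦ y₁ ⟧ + ⟦ a ⟧ * ⟦ y₂ ⟧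
      images : s₁ + ⟦ z₁ ⟧ ≡ s₁ + ⟦ z₁′ ⟧ [modℤ N ] × s₂ + ⟦ z₂ ⟧ ≡ s₂ + ⟦ z₂′ ⟧ [modℤ N ]
      images = incidentB-common (a , b , z₁ , z₂) (a , b , z₁′ , z₂′) x (y₁ , y₂) m·y≡x m′·y≡x
      images₁ = proj₁ images
      images₂ = proj₂ images

    module _ {{_ : NonZero N}} where

      image : Motion N → Pt N → Pt N
      image m y = residue (image₁ m y) , residue (image₂ m y)

      incidentB-image : ∀ m y → incidentB N m (image m y) y ≡ true
      incidentB-image m y = Equivalence.from (incidentB⇔Sends m (image m y) y)
        (residue-≡modℤ (image₁ m y) , residue-≡modℤ (image₂ m y))

  module _ {p : ℕ} (prime : Prime p) (k : ℕ) where

    incidentB-far-unique : ∀ a b a′ b′ z z′ x x′ y y′ →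
      ¬ + p ∣ sqDist ⟦ a ⟧ ⟦ b ⟧ ⟦ a′ ⟧ ⟦ b′ ⟧ →
      incidentB (p ^ k) (a , b , z) x y ≡ true → incidentB (p ^ k) (a′ , b′ , z′) x y ≡ true →
      incidentB (p ^ k) (a , b , z) x′ y′ ≡ true → incidentB (p ^ k) (a′ , b′ , z′) x′ y′ ≡ true →
      y ≡ y′
    incidentB-far-unique a b a′ b′ z z′ x x′ (y₁ , y₂) (y₁′ , y₂′) far m·y m′·y m·y′ m′·y′ =
      Pt-≡modℤ⇒≡ (≡modℤ (proj₁ cancelled)) (≡modℤ (proj₂ cancelled))
      where
      q = p ^ k
      m m′ : Motion q
      m  = a , b , z
      m′ = a′ , b′ , z′
      y y′ : Pt q
      y  = y₁ , y₂
      y′ = y₁′ , y₂′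
      u = ⟦ y₁ ⟧ - ⟦ y₁′ ⟧
      v = ⟦ y₂ ⟧ - ⟦ y₂′ ⟧
      at-y  = incidentB-common m m′ x y m·y m′·y
      at-y′ = incidentB-common m m′ x′ y′ m·y′ m′·y′
      second-difference₁ : (image₁ m y - image₁ m′ y) - (image₁ m y′ - image₁ m′ y′)
                           ≡ (⟦ a ⟧ - ⟦ a′ ⟧) * u - (⟦ b ⟧ - ⟦ b′ ⟧) * v
      second-difference₁ = begin
        (image₁ m y - image₁ m′ y) - (image₁ m y′ - image₁ m′ y′)
          ≡⟨ swap-differences (image₁ m y) (image₁ m′ y) (image₁ m y′) (image₁ m′ y′) ⟩
        (image₁ m y - image₁ m y′) - (image₁ m′ y - image₁ m′ y′)
          ≡⟨ cong₂ _-_ (image₁-difference ⟦ a ⟧ ⟦ b ⟧ ⟦ y₁ ⟧ ⟦ y₂ ⟧ ⟦ y₁′ ⟧ ⟦ y₂′ ⟧ ⟦ proj₁ z ⟧)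
                       (image₁-difference ⟦ a′ ⟧ ⟦ b′ ⟧ ⟦ y₁ ⟧ ⟦ y₂ ⟧ ⟦ y₁′ ⟧ ⟦ y₂′ ⟧ ⟦ proj₁ z′ ⟧) ⟩
        (⟦ a ⟧ * u - ⟦ b ⟧ * v) - (⟦ a′ ⟧ * u - ⟦ b′ ⟧ * v)
          ≡⟨ collect₁ ⟦ a ⟧ ⟦ b ⟧ ⟦ a′ ⟧ ⟦ b′ ⟧ u v ⟩
        (⟦ a ⟧ - ⟦ a′ ⟧) * u - (⟦ b ⟧ - ⟦ b′ ⟧) * v ∎
        where open ≡-Reasoning
      second-difference₂ : (image₂ m y - image₂ m′ y) - (image₂ m y′ - image₂ m′ y′)
                           ≡ (⟦ b ⟧ - ⟦ b′ ⟧) * u + (⟦ a ⟧ - ⟦ a′ ⟧) * v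
      second-difference₂ = begin
        (image₂ m y - image₂ m′ y) - (image₂ m y′ - image₂ m′ y′)
          ≡⟨ swap-differences (image₂ m y) (image₂ m′ y) (image₂ m y′) (image₂ m′ y′) ⟩
        (image₂ m y - image₂ m y′) - (image₂ m′ y - image₂ m′ y′)
          ≡⟨ cong₂ _-_ (image₂-difference ⟦ a ⟧ ⟦ b ⟧ ⟦ y₁ ⟧ ⟦ y₂ ⟧ ⟦ y₁′ ⟧ ⟦ y₂′ ⟧ ⟦ proj₂ z ⟧)
                       (image₂-difference ⟦ a′ ⟧ ⟦ b′ ⟧ ⟦ y₁ ⟧ ⟦ y₂ ⟧ ⟦ y₁′ ⟧ ⟦ y₂′ ⟧ ⟦ proj₂ z′ ⟧) ⟩
        (⟦ b ⟧ * u + ⟦ a ⟧ * v) - (⟦ b′ ⟧ * u + ⟦ a′ ⟧ * v)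
          ≡⟨ collect₂ ⟦ a ⟧ ⟦ b ⟧ ⟦ a′ ⟧ ⟦ b′ ⟧ u v ⟩
        (⟦ b ⟧ - ⟦ b′ ⟧) * u + (⟦ a ⟧ - ⟦ a′ ⟧) * v ∎
        where open ≡-Reasoning
      cancelled : + q ∣ u × + q ∣ v
      cancelled = unit-norm⇒cancel prime k (⟦ a ⟧ - ⟦ a′ ⟧) (⟦ b ⟧ - ⟦ b′ ⟧) u v far
        (subst (+ q ∣_) second-difference₁
          (∣m∣n⇒∣m-n (difference-divisible (proj₁ at-y)) (difference-divisible (proj₁ at-y′))))
        (subst (+ q ∣_) second-difference₂
          (∣m∣n⇒∣m-n (difference-divisible (proj₂ at-y)) (difference-divisible (proj₂ at-y′))))

module NearbyRotations where

  open import Data.Nat as ℕ using (ℕ; suc; NonZero; _^_)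
  import Data.Nat.Properties as ℕ
  import Data.Nat.Divisibility as ℕ
  open import Data.Nat.DivMod using (_/_; m<n*o⇒m/o<n; m/n*n≡m)
  open import Data.Nat.Primality using (Prime; prime⇒nonZero)
  open import Data.Integer using (ℤ; +_; _*_; -_; _≤_; _%ℕ_)
  open import Data.Integer.DivMod using (n%ℕd<d)
  open import Data.Integer.Divisibility.Signed
  open import Data.Fin using (Fin; toℕ; fromℕ<)
  open import Data.Fin.Properties using (toℕ-fromℕ<)
  open import Data.Product using (_×_; _,_; proj₁; proj₂)
  open import Relation.Binary.PropositionalEquality
  open import Relation.Nullary using (Dec; does; _×-dec_)
  open import Defs
  open FiniteSums
  open Enumerations
  open Congruences
  open RotationAlgebra
  open RigidMotions

  module _ {p : ℕ} (prime : Prime p) (2<p : 2 ℕ.< p) (k : ℕ) where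

    private
      N M : ℕ
      N = p ^ suc k
      M = p ^ k
      instance
        p≢0 : NonZero p
        p≢0 = prime⇒nonZero prime
        N≢0 : NonZero N
        N≢0 = ℕ.>-nonZero (ℕ.m^n>0 p (suc k))

    Near : Pt N → Pt N → Set
    Near (a , b) (a′ , b′) = IsRot N a′ b′ × + p ∣ sqDist ⟦ a ⟧ ⟦ b ⟧ ⟦ a′ ⟧ ⟦ b′ ⟧

    near? : ∀ g g′ → Dec (Near g g′)
    near? (a , b) (a′ , b′) = isRot? a′ b′ ×-dec (+ p ∣? sqDist ⟦ a ⟧ ⟦ b ⟧ ⟦ a′ ⟧ ⟦ b′ ⟧)

    private
      sine : Pt N → Pt N → ℤ
      sine (a , b) (a′ , b′) = cross ⟦ a ⟧ ⟦ b ⟧ ⟦ a′ ⟧ ⟦ b′ ⟧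

      sine%N<M*p : ∀ g g′ → sine g g′ %ℕ N ℕ.< M ℕ.* p
      sine%N<M*p g g′ = subst (sine g g′ %ℕ N ℕ.<_) (ℕ.*-comm p M) (n%ℕd<d (sine g g′) N)

      p∣N : p ℕ.∣ N
      p∣N = ℕ.m∣m*n M

    -- For g′ near g the sine of g⁻¹ g′ is a multiple of p, so its residue modulo N = p · M,
    -- divided by p, loses nothing and lands in Fin M.
    sineIndex : Pt N → Pt N → Fin M
    sineIndex g g′ = fromℕ< (m<n*o⇒m/o<n (sine%N<M*p g g′))

    sineIndex-injective : ∀ {a b} g₁ g₂ → IsRot N a b → Near (a , b) g₁ → Near (a , b) g₂ →
                          sineIndex (a , b) g₁ ≡ sineIndex (a , b) g₂ → g₁ ≡ g₂
    sineIndex-injective {a} {b} (a₁ , b₁) (a₂ , b₂) rot (rot₁ , close₁) (rot₂ , close₂) same-index =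
      Pt-≡modℤ⇒≡ (proj₁ coincide) (proj₂ coincide)
      where
      g = a , b
      unit  = IsRot⇒unit a b rot
      unit₁ = IsRot⇒unit a₁ b₁ rot₁
      unit₂ = IsRot⇒unit a₂ b₂ rot₂
      relative₁ = close⇒relative≡1 prime 2<p {⟦ a ⟧} {⟦ b ⟧} {⟦ a₁ ⟧} {⟦ b₁ ⟧}
                    (modℤ-divisor p∣N unit) (modℤ-divisor p∣N unit₁) close₁
      relative₂ = close⇒relative≡1 prime 2<p {⟦ a ⟧} {⟦ b ⟧} {⟦ a₂ ⟧} {⟦ b₂ ⟧}
                    (modℤ-divisor p∣N unit) (modℤ-divisor p∣N unit₂) close₂
      p∣sine%N : ∀ g′ → + p ∣ sine g g′ → p ℕ.∣ sine g g′ %ℕ N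
      p∣sine%N g′ p∣sine = ∣⇒∣ᵤ {i = + (sine g g′ %ℕ N)} (∣m+n∣n⇒∣m {n = - sine g g′}
        (difference-divisible (modℤ-divisor p∣N (%ℕ-≡modℤ (sine g g′)))) (∣m⇒∣-m p∣sine))
      same-quotient : sine g (a₁ , b₁) %ℕ N / p ≡ sine g (a₂ , b₂) %ℕ N / p
      same-quotient = trans (sym (toℕ-fromℕ< (m<n*o⇒m/o<n (sine%N<M*p g (a₁ , b₁)))))
                     (trans (cong toℕ same-index) (toℕ-fromℕ< (m<n*o⇒m/o<n (sine%N<M*p g (a₂ , b₂)))))
      same-residue : sine g (a₁ , b₁) %ℕ N ≡ sine g (a₂ , b₂) %ℕ N
      same-residue = trans (sym (m/n*n≡m (p∣sine%N (a₁ , b₁) (proj₂ relative₁))))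
                    (trans (cong (ℕ._* p) same-quotient) (m/n*n≡m (p∣sine%N (a₂ , b₂) (proj₂ relative₂))))
      same-sine : sine g (a₁ , b₁) ≡ sine g (a₂ , b₂) [modℤ N ]
      same-sine = modℤ-trans (modℤ-sym (%ℕ-≡modℤ (sine g (a₁ , b₁))))
                    (subst (λ e → + e ≡ sine g (a₂ , b₂) [modℤ N ]) (sym same-residue) (%ℕ-≡modℤ (sine g (a₂ , b₂))))
      coincide = close-and-same-cross⇒≡ prime 2<p (suc k) {⟦ a ⟧} {⟦ b ⟧} {⟦ a₁ ⟧} {⟦ b₁ ⟧} {⟦ a₂ ⟧} {⟦ b₂ ⟧}
                   unit unit₁ unit₂ (proj₁ relative₁) (proj₁ relative₂) same-sine

    near-count : ∀ {a b} → IsRot N a b → ∑[ g′ ∈ points N ] 𝟙 (does (near? (a , b) g′)) ≤ + M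
    near-count {a} {b} rot = ∑-injective-≤ (sineIndex (a , b)) (λ g′ → 𝟙 (does (near? (a , b) g′)))
      (points-unique N) (λ g′ → 0≤𝟙 _) (λ g′ → 𝟙≤1 _)
      λ {g₁} {g₂} near₁ near₂ → sineIndex-injective g₁ g₂ rot
        (does⇒ (near? (a , b) g₁) (0<𝟙⇒true _ near₁)) (does⇒ (near? (a , b) g₂) (0<𝟙⇒true _ near₂))

module IncidenceMoments where

  open import Data.Nat as ℕ using (ℕ; suc; NonZero; _^_)
  import Data.Nat.Properties as ℕ
  open import Data.Nat.Primality using (Prime; prime⇒nonZero)
  open import Data.Integer using (ℤ; +_; 0ℤ; 1ℤ; _+_; _*_; _-_; -_; _≤_; _<_; +≤+)
  open import Data.Integer.Properties
  open import Data.Integer.Tactic.RingSolver using (solve-∀)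
  open import Data.Bool using (Bool; true; false)
  open import Data.Product using (_×_; _,_; proj₁; proj₂; Σ-syntax)
  open import Data.List.Relation.Unary.Any using (satisfied)
  open import Relation.Binary.PropositionalEquality
  open import Relation.Nullary using (¬_; does)
  open import Defs
  open FiniteSums
  open CauchySchwarz
  open Enumerations
  open RotationAlgebra
  open RigidMotions
  open NearbyRotations

  private
    variance-identity : ∀ n r m → n * n * (r * (r + m * n)) + (- (+ 2 * n * r)) * (r * n) + r * r * (n * n)
                                ≡ n * n * n * m * r
    variance-identity = solve-∀

    weighted-shift : ∀ w n k r → w * (n * k - r) ≡ n * (w * k) + (- r) * w
    weighted-shift = solve-∀

    regroup-product : ∀ r r′ i i′ → (r * i) * (r′ * i′) ≡ r * (r′ * (i * i′))
    regroup-product = solve-∀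

  module _ {N : ℕ} where

    incidence : Motion N → Pt N → Pt N → ℤ
    incidence m x y = 𝟙 (incidentB N m x y)

    common : Motion N → Motion N → Pt N → ℤ
    common m m′ y = ∑[ x ∈ points N ] (incidence m x y * incidence m′ x y)

    coincidences : Motion N → Motion N → ℤ
    coincidences m m′ = ∑[ y ∈ points N ] common m m′ y

    0≤common : ∀ m m′ y → 0ℤ ≤ common m m′ y
    0≤common m m′ y = ∑-nonNeg (points N) (λ x → 0≤𝟙*𝟙 (incidentB N m x y) (incidentB N m′ x y))

    0≤coincidences : ∀ m m′ → 0ℤ ≤ coincidences m m′
    0≤coincidences m m′ = ∑-nonNeg (points N) (0≤common m m′)

    common-witness : ∀ m m′ y → 0ℤ < common m m′ y →
                     Σ[ x ∈ Pt N ] incidentB N m x y ≡ true × incidentB N m′ x y ≡ true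
    common-witness m m′ y 0<common with satisfied (∑-pos⇒any (points N) _ 0<common)
    ... | x , 0<product = x , 0<𝟙*𝟙⇒true (incidentB N m x y) (incidentB N m′ x y) 0<product

    common≤1 : ∀ m m′ y → common m m′ y ≤ 1ℤ
    common≤1 m m′ y = ∑-atMostOne (points-unique N) (λ x → 0≤𝟙*𝟙 (incidentB N m x y) (incidentB N m′ x y))
                                      (λ x → 𝟙*𝟙≤1 (incidentB N m x y) (incidentB N m′ x y))
      λ {x} {x′} both both′ → incidentB-functional m y x x′
        (proj₁ (0<𝟙*𝟙⇒true (incidentB N m x y) (incidentB N m′ x y) both))
        (proj₁ (0<𝟙*𝟙⇒true (incidentB N m x′ y) (incidentB N m′ x′ y) both′))

    ∑-translations-coincidences≤N² : ∀ m a′ b′ →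
      ∑[ z′ ∈ points N ] coincidences m (a′ , b′ , z′) ≤ + N * + N
    ∑-translations-coincidences≤N² m a′ b′ = begin
      ∑[ z′ ∈ points N ] ∑[ y ∈ points N ] common m (a′ , b′ , z′) y
        ≡⟨ ∑-comm (points N) (points N) (λ z′ y → common m (a′ , b′ , z′) y) ⟩
      ∑[ y ∈ points N ] ∑[ z′ ∈ points N ] common m (a′ , b′ , z′) y
        ≤⟨ ∑-mono-≤ (points N) ∑-translations-common≤1 ⟩
      ∑[ y ∈ points N ] 1ℤ
        ≡⟨ ∑[points]-1 {N} ⟩
      + N * + N ∎
      where
      open ≤-Reasoning
      ∑-translations-common≤1 : ∀ y → ∑[ z′ ∈ points N ] common m (a′ , b′ , z′) y ≤ 1ℤ
      ∑-translations-common≤1 y = ∑-atMostOne (points-unique N) (λ z′ → 0≤common m (a′ , b′ , z′) y)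
                                                (λ z′ → common≤1 m (a′ , b′ , z′) y)
        λ {z′} {z″} 0<common′ 0<common″ →
          let (x′ , m·y≡x′ , m′·y≡x′) = common-witness m (a′ , b′ , z′) y 0<common′
              (x″ , m·y≡x″ , m″·y≡x″) = common-witness m (a′ , b′ , z″) y 0<common″
          in incidentB-translation a′ b′ z′ z″ x′ y m′·y≡x′
               (subst (λ x → incidentB N (a′ , b′ , z″) x y ≡ true)
                      (sym (incidentB-functional m y x′ x″ m·y≡x′ m·y≡x″)) m″·y≡x″)

    module _ (R : Motion N → Bool) where

      cardᶻ : ℤ
      cardᶻ = ∑[ m ∈ motions N ] 𝟙 (R m)

      multiplicity : Pt N × Pt N → ℤ
      multiplicity xy = ∑[ m ∈ motions N ] (𝟙 (R m) * incidence m (proj₁ xy) (proj₂ xy))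

      multiplicity²-expansion : ∑[ xy ∈ pairs N ] (multiplicity xy * multiplicity xy)
        ≡ ∑[ m ∈ motions N ] (𝟙 (R m) * ∑[ m′ ∈ motions N ] (𝟙 (R m′) * coincidences m m′))
      multiplicity²-expansion = begin
        ∑[ xy ∈ pairs N ] (multiplicity xy * multiplicity xy)
          ≡⟨ ∑-cong (pairs N) (λ xy → ∑-product (motions N) (motions N) (term xy) (term xy)) ⟨
        ∑[ xy ∈ pairs N ] ∑[ m ∈ motions N ] ∑[ m′ ∈ motions N ] (term xy m * term xy m′)
          ≡⟨ ∑-comm (pairs N) (motions N) (λ xy m → ∑[ m′ ∈ motions N ] (term xy m * term xy m′)) ⟩
        ∑[ m ∈ motions N ] ∑[ xy ∈ pairs N ] ∑[ m′ ∈ motions N ] (term xy m * term xy m′)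
          ≡⟨ ∑-cong (motions N) (λ m → ∑-comm (pairs N) (motions N) (λ xy m′ → term xy m * term xy m′)) ⟩
        ∑[ m ∈ motions N ] ∑[ m′ ∈ motions N ] ∑[ xy ∈ pairs N ] (term xy m * term xy m′)
          ≡⟨ ∑-cong (motions N) (λ m → ∑-cong (motions N) (λ m′ → ∑-pair-terms m m′)) ⟩
        ∑[ m ∈ motions N ] ∑[ m′ ∈ motions N ] (𝟙 (R m) * (𝟙 (R m′) * coincidences m m′))
          ≡⟨ ∑-cong (motions N) (λ m → ∑-distribˡ-* (motions N) (𝟙 (R m)) _) ⟩
        ∑[ m ∈ motions N ] (𝟙 (R m) * ∑[ m′ ∈ motions N ] (𝟙 (R m′) * coincidences m m′)) ∎
        where
        open ≡-Reasoning
        term : Pt N × Pt N → Motion N → ℤ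
        term xy m = 𝟙 (R m) * incidence m (proj₁ xy) (proj₂ xy)
        ∑-pair-terms : ∀ m m′ → ∑[ xy ∈ pairs N ] (term xy m * term xy m′) ≡ 𝟙 (R m) * (𝟙 (R m′) * coincidences m m′)
        ∑-pair-terms m m′ = begin
          ∑[ xy ∈ pairs N ] (term xy m * term xy m′)
            ≡⟨ ∑-cong (pairs N) (λ xy → regroup-product (𝟙 (R m)) (𝟙 (R m′)) _ _) ⟩
          ∑[ xy ∈ pairs N ] (𝟙 (R m) * (𝟙 (R m′) * both (proj₁ xy) (proj₂ xy)))
            ≡⟨ ∑-distribˡ-* (pairs N) (𝟙 (R m)) _ ⟩
          𝟙 (R m) * ∑[ xy ∈ pairs N ] (𝟙 (R m′) * both (proj₁ xy) (proj₂ xy))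
            ≡⟨ cong (𝟙 (R m) *_) (∑-distribˡ-* (pairs N) (𝟙 (R m′)) _) ⟩
          𝟙 (R m) * (𝟙 (R m′) * ∑[ xy ∈ pairs N ] both (proj₁ xy) (proj₂ xy))
            ≡⟨ cong (λ c → 𝟙 (R m) * (𝟙 (R m′) * c)) (trans (∑-pairs both) (∑-comm (points N) (points N) both)) ⟩
          𝟙 (R m) * (𝟙 (R m′) * coincidences m m′) ∎
          where
          both : Pt N → Pt N → ℤ
          both x y = incidence m x y * incidence m′ x y

    module _ {{_ : NonZero N}} where

      ∑ₓ-incidence : ∀ m y → ∑[ x ∈ points N ] incidence m x y ≡ 1ℤ
      ∑ₓ-incidence m y = ≤-antisym
        (∑-atMostOne (points-unique N) (λ x → 0≤𝟙 _) (λ x → 𝟙≤1 _)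
          (λ {x} {x′} m·y≡x m·y≡x′ → incidentB-functional m y x x′ (0<𝟙⇒true _ m·y≡x) (0<𝟙⇒true _ m·y≡x′)))
        (subst (_≤ ∑[ x ∈ points N ] incidence m x y) (cong 𝟙 (incidentB-image m y))
          (term≤∑ (points N) (λ x → 0≤𝟙 _) (∈-points (image m y))))

      ∑-incidence : ∀ m → ∑[ xy ∈ pairs N ] incidence m (proj₁ xy) (proj₂ xy) ≡ + N * + N
      ∑-incidence m = begin
        ∑[ xy ∈ pairs N ] incidence m (proj₁ xy) (proj₂ xy)    ≡⟨ ∑-pairs (incidence m) ⟩
        ∑[ x ∈ points N ] ∑[ y ∈ points N ] incidence m x y    ≡⟨ ∑-comm (points N) (points N) (incidence m) ⟩
        ∑[ y ∈ points N ] ∑[ x ∈ points N ] incidence m x y    ≡⟨ ∑-cong (points N) (∑ₓ-incidence m) ⟩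
        ∑[ y ∈ points N ] 1ℤ                                   ≡⟨ ∑[points]-1 {N} ⟩
        + N * + N                                              ∎
        where open ≡-Reasoning

      first-moment : ∀ R → ∑[ xy ∈ pairs N ] multiplicity R xy ≡ cardᶻ R * (+ N * + N)
      first-moment R = begin
        ∑[ xy ∈ pairs N ] ∑[ m ∈ motions N ] (𝟙 (R m) * incidence m (proj₁ xy) (proj₂ xy))
          ≡⟨ ∑-comm (pairs N) (motions N) (λ xy m → 𝟙 (R m) * incidence m (proj₁ xy) (proj₂ xy)) ⟩
        ∑[ m ∈ motions N ] ∑[ xy ∈ pairs N ] (𝟙 (R m) * incidence m (proj₁ xy) (proj₂ xy))
          ≡⟨ ∑-cong (motions N) (λ m →
               trans (∑-distribˡ-* (pairs N) (𝟙 (R m)) _) (cong (𝟙 (R m) *_) (∑-incidence m))) ⟩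
        ∑[ m ∈ motions N ] (𝟙 (R m) * (+ N * + N))
          ≡⟨ ∑-distribʳ-* (motions N) (+ N * + N) (λ m → 𝟙 (R m)) ⟩
        cardᶻ R * (+ N * + N) ∎
        where open ≡-Reasoning


  module _ {p : ℕ} (prime : Prime p) (2<p : 2 ℕ.< p) (k : ℕ) where

    private
      N M : ℕ
      N = p ^ suc k
      M = p ^ k
      instance
        p≢0 : NonZero p
        p≢0 = prime⇒nonZero prime
        N≢0 : NonZero N
        N≢0 = ℕ.>-nonZero (ℕ.m^n>0 p (suc k))
      N² : ℤ
      N² = + N * + N
      0≤N² : 0ℤ ≤ N²
      0≤N² = 0≤i*j {+ N} {+ N} (+≤+ ℕ.z≤n) (+≤+ ℕ.z≤n)

    far-coincidences≤1 : ∀ a b z a′ b′ z′ → IsRot N a′ b′ → ¬ Near prime 2<p k (a , b) (a′ , b′) →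
                         coincidences (a , b , z) (a′ , b′ , z′) ≤ 1ℤ
    far-coincidences≤1 a b z a′ b′ z′ rot′ far = ∑-atMostOne (points-unique N)
      (0≤common (a , b , z) (a′ , b′ , z′)) (common≤1 (a , b , z) (a′ , b′ , z′))
      λ {y} {y′} 0<common 0<common′ →
        let (x  , m·y≡x   , m′·y≡x)   = common-witness (a , b , z) (a′ , b′ , z′) y 0<common
            (x′ , m·y′≡x′ , m′·y′≡x′) = common-witness (a , b , z) (a′ , b′ , z′) y′ 0<common′
        in incidentB-far-unique prime (suc k) a b a′ b′ z z′ x x′ y y′ (λ close → far (rot′ , close))
             m·y≡x m′·y≡x m·y′≡x′ m′·y′≡x′

    module _ (R : Motion N → Bool) (R⊆SO₂ : ∀ a b z → R (a , b , z) ≡ true → IsRot N a b) where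

      ∑-translations-energy≤N² : ∀ m a′ b′ →
        ∑[ z′ ∈ points N ] (𝟙 (R (a′ , b′ , z′)) * coincidences m (a′ , b′ , z′)) ≤ N²
      ∑-translations-energy≤N² m a′ b′ = ≤-trans
        (∑-mono-≤ (points N) λ z′ → subst (𝟙 (R (a′ , b′ , z′)) * coincidences m (a′ , b′ , z′) ≤_)
          (*-identityˡ _) (*-monoʳ-≤-0≤ (0≤coincidences m (a′ , b′ , z′)) (𝟙≤1 (R (a′ , b′ , z′)))))
        (∑-translations-coincidences≤N² m a′ b′)

      ∑-translations-energy-far : ∀ a b z a′ b′ → ¬ Near prime 2<p k (a , b) (a′ , b′) →
        ∑[ z′ ∈ points N ] (𝟙 (R (a′ , b′ , z′)) * coincidences (a , b , z) (a′ , b′ , z′))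
        ≤ ∑[ z′ ∈ points N ] 𝟙 (R (a′ , b′ , z′))
      ∑-translations-energy-far a b z a′ b′ far = ∑-mono-≤ (points N) at-most-𝟙
        where
        at-most-𝟙 : ∀ z′ → 𝟙 (R (a′ , b′ , z′)) * coincidences (a , b , z) (a′ , b′ , z′) ≤ 𝟙 (R (a′ , b′ , z′))
        at-most-𝟙 z′ with R (a′ , b′ , z′) in m′∈R
        ... | false = ≤-refl
        ... | true  = subst (_≤ 1ℤ) (sym (*-identityˡ _))
                        (far-coincidences≤1 a b z a′ b′ z′ (R⊆SO₂ a′ b′ z′ m′∈R) far)

      energy≤ : ∀ a b z → IsRot N a b →
        ∑[ m′ ∈ motions N ] (𝟙 (R m′) * coincidences (a , b , z) m′) ≤ cardᶻ R + + M * N²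
      energy≤ a b z rot = begin
        ∑[ m′ ∈ motions N ] (𝟙 (R m′) * coincidences m m′)
          ≡⟨ ∑-motions (λ m′ → 𝟙 (R m′) * coincidences m m′) ⟩
        ∑[ g′ ∈ points N ] ∑[ z′ ∈ points N ] (𝟙 (R (g′ ⊕ z′)) * coincidences m (g′ ⊕ z′))
          ≤⟨ ∑-mono-≤ (points N) (λ g′ → ≤+𝟙-does* (near? prime 2<p k (a , b) g′)
               (∑-nonNeg (points N) (λ z′ → 0≤𝟙 (R (g′ ⊕ z′))))
               (λ _ → ∑-translations-energy≤N² m (proj₁ g′) (proj₂ g′))
               (∑-translations-energy-far a b z (proj₁ g′) (proj₂ g′))) ⟩
        ∑[ g′ ∈ points N ] (∑[ z′ ∈ points N ] 𝟙 (R (g′ ⊕ z′)) + nearby g′ * N²)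
          ≡⟨ ∑-distrib-+ (points N) _ _ ⟩
        ∑[ g′ ∈ points N ] ∑[ z′ ∈ points N ] 𝟙 (R (g′ ⊕ z′)) + ∑[ g′ ∈ points N ] (nearby g′ * N²)
          ≡⟨ cong₂ _+_ (sym (∑-motions (λ m′ → 𝟙 (R m′)))) (∑-distribʳ-* (points N) N² nearby) ⟩
        cardᶻ R + ∑[ g′ ∈ points N ] nearby g′ * N²
          ≤⟨ +-monoʳ-≤ (cardᶻ R) (*-monoʳ-≤-0≤ 0≤N² (near-count prime 2<p k rot)) ⟩
        cardᶻ R + + M * N² ∎
        where
        open ≤-Reasoning
        m = a , b , z
        _⊕_ : Pt N → Pt N → Motion N
        g′ ⊕ z′ = proj₁ g′ , proj₂ g′ , z′
        nearby : Pt N → ℤ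
        nearby g′ = 𝟙 (does (near? prime 2<p k (a , b) g′))

      second-moment : ∑[ xy ∈ pairs N ] (multiplicity R xy * multiplicity R xy) ≤ cardᶻ R * (cardᶻ R + + M * N²)
      second-moment = begin
        ∑[ xy ∈ pairs N ] (multiplicity R xy * multiplicity R xy)
          ≡⟨ multiplicity²-expansion R ⟩
        ∑[ m ∈ motions N ] (𝟙 (R m) * ∑[ m′ ∈ motions N ] (𝟙 (R m′) * coincidences m m′))
          ≤⟨ ∑-mono-≤ (motions N) energy-bound ⟩
        ∑[ m ∈ motions N ] (𝟙 (R m) * (cardᶻ R + + M * N²))
          ≡⟨ ∑-distribʳ-* (motions N) (cardᶻ R + + M * N²) (λ m → 𝟙 (R m)) ⟩
        cardᶻ R * (cardᶻ R + + M * N²) ∎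
        where
        open ≤-Reasoning
        energy-bound : ∀ m → 𝟙 (R m) * ∑[ m′ ∈ motions N ] (𝟙 (R m′) * coincidences m m′)
                             ≤ 𝟙 (R m) * (cardᶻ R + + M * N²)
        energy-bound (a , b , z) with R (a , b , z) in m∈R
        ... | false = ≤-refl
        ... | true  = *-monoˡ-≤-nonNeg 1ℤ (energy≤ a b z (R⊆SO₂ a b z m∈R))

      variance : ∑[ xy ∈ pairs N ] ((N² * multiplicity R xy - cardᶻ R) * (N² * multiplicity R xy - cardᶻ R))
                 ≤ N² * N² * N² * + M * cardᶻ R
      variance = begin
        ∑[ xy ∈ pairs N ] ((N² * K xy - ρ) * (N² * K xy - ρ))
          ≡⟨ ∑-affine² (pairs N) K N² ρ ⟩
        N² * N² * ∑[ xy ∈ pairs N ] (K xy * K xy) + (- (+ 2 * N² * ρ)) * ∑[ xy ∈ pairs N ] K xy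
          + ρ * ρ * ∑[ xy ∈ pairs N ] 1ℤ
          ≡⟨ cong₂ (λ s₁ s₀ → N² * N² * ∑[ xy ∈ pairs N ] (K xy * K xy) + (- (+ 2 * N² * ρ)) * s₁ + ρ * ρ * s₀)
                   (first-moment R) (∑[pairs]-1 {N}) ⟩
        N² * N² * ∑[ xy ∈ pairs N ] (K xy * K xy) + (- (+ 2 * N² * ρ)) * (ρ * N²) + ρ * ρ * (N² * N²)
          ≤⟨ +-monoˡ-≤ (ρ * ρ * (N² * N²)) (+-monoˡ-≤ ((- (+ 2 * N² * ρ)) * (ρ * N²))
               (*-monoˡ-≤-0≤ (0≤i*j 0≤N² 0≤N²) second-moment)) ⟩
        N² * N² * (ρ * (ρ + + M * N²)) + (- (+ 2 * N² * ρ)) * (ρ * N²) + ρ * ρ * (N² * N²)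
          ≡⟨ variance-identity N² ρ (+ M) ⟩
        N² * N² * N² * + M * ρ ∎
        where
        open ≤-Reasoning
        K = multiplicity R
        ρ = cardᶻ R

      module _ (A B : Pt N → Bool) where

        private
          w : Pt N × Pt N → ℤ
          w xy = 𝟙 (A (proj₁ xy)) * 𝟙 (B (proj₂ xy))

        discrepancy :
          let W = ∑[ xy ∈ pairs N ] w xy
              I = ∑[ xy ∈ pairs N ] (w xy * multiplicity R xy)
          in (N² * I - W * cardᶻ R) * (N² * I - W * cardᶻ R) ≤ W * (N² * N² * N² * + M * cardᶻ R)
        discrepancy = begin
          (N² * I - W * ρ) * (N² * I - W * ρ)
            ≡⟨ cong₂ _*_ weighted-sum weighted-sum ⟨
          ∑[ xy ∈ pairs N ] (w xy * c xy) * ∑[ xy ∈ pairs N ] (w xy * c xy)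
            ≤⟨ cauchy-schwarz-01 (pairs N) w c (λ xy → 0≤𝟙*𝟙 (A (proj₁ xy)) (B (proj₂ xy)))
                                                (λ xy → 𝟙*𝟙≤1 (A (proj₁ xy)) (B (proj₂ xy))) ⟩
          W * ∑[ xy ∈ pairs N ] (c xy * c xy)
            ≤⟨ *-monoˡ-≤-0≤ (∑-nonNeg (pairs N) (λ xy → 0≤𝟙*𝟙 (A (proj₁ xy)) (B (proj₂ xy)))) variance ⟩
          W * (N² * N² * N² * + M * ρ) ∎
          where
          open ≤-Reasoning
          ρ = cardᶻ R
          W = ∑[ xy ∈ pairs N ] w xy
          I = ∑[ xy ∈ pairs N ] (w xy * multiplicity R xy)
          c : Pt N × Pt N → ℤ
          c xy = N² * multiplicity R xy - ρ
          weighted-sum : ∑[ xy ∈ pairs N ] (w xy * c xy) ≡ N² * I - W * ρ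
          weighted-sum = begin-equality
            ∑[ xy ∈ pairs N ] (w xy * c xy)
              ≡⟨ ∑-cong (pairs N) (λ xy → weighted-shift (w xy) N² (multiplicity R xy) ρ) ⟩
            ∑[ xy ∈ pairs N ] (N² * (w xy * multiplicity R xy) + (- ρ) * w xy)
              ≡⟨ ∑-distrib-+ (pairs N) _ _ ⟩
            ∑[ xy ∈ pairs N ] (N² * (w xy * multiplicity R xy)) + ∑[ xy ∈ pairs N ] ((- ρ) * w xy)
              ≡⟨ cong₂ _+_ (∑-distribˡ-* (pairs N) N² _) (∑-distribˡ-* (pairs N) (- ρ) w) ⟩
            N² * I + (- ρ) * W
              ≡⟨ cong (_+_ (N² * I)) (neg-distribˡ-* ρ W) ⟨
            N² * I - ρ * W
              ≡⟨ cong (λ t → N² * I - t) (*-comm ρ W) ⟩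
            N² * I - W * ρ ∎

module Discrepancy where

  open import Data.Nat as ℕ using (ℕ; suc; NonZero; _^_; _∸_)
  import Data.Nat.Properties as ℕ
  import Data.Nat.Tactic.RingSolver as ℕ-Solver
  open import Data.Nat.ListAction using (sum)
  open import Data.Nat.Primality using (Prime; prime⇒nonZero)
  open import Data.Integer using (ℤ; +_; _+_; _*_; _-_; _≤_)
  open import Data.Integer.Properties using (pos-+; pos-*; module ≤-Reasoning)
  open import Data.Integer.Tactic.RingSolver using (solve-∀)
  open import Data.Fin using (Fin)
  open import Data.List using ([]; _∷_; map; allFin; cartesianProduct)
  open import Data.Bool using (Bool; true; _∧_)
  open import Data.Product using (_,_; proj₁; proj₂)
  open import Relation.Binary.PropositionalEquality
  open import Defs
  open FiniteSums
  open Enumerations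
  open IncidenceMoments

  +sum-map : ∀ {X : Set} (f : X → ℕ) xs → + sum (map f xs) ≡ ∑[ x ∈ xs ] (+ f x)
  +sum-map f []       = refl
  +sum-map f (x ∷ xs) = trans (pos-+ (f x) _) (cong (_+_ (+ f x)) (+sum-map f xs))

  private
    𝟙-∧⁴ : ∀ r a b i → + ind (r ∧ a ∧ b ∧ i) ≡ 𝟙 r * (𝟙 a * (𝟙 b * 𝟙 i))
    𝟙-∧⁴ r a b i = trans (𝟙-∧ r _) (cong (𝟙 r *_) (trans (𝟙-∧ a _) (cong (𝟙 a *_) (𝟙-∧ b i))))

    regroup-incidence : ∀ r a b i → r * (a * (b * i)) ≡ a * b * (r * i)
    regroup-incidence = solve-∀

    regroup-bound : ∀ n m w r → w * (n * n * n * m * r) ≡ n * n * n * m * w * r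
    regroup-bound = solve-∀

  module _ {N : ℕ} where

    +∑ : ∀ (f : Fin N → ℕ) → + ∑ N f ≡ ∑[ i ∈ allFin N ] (+ f i)
    +∑ f = +sum-map f (allFin N)

    +∑² : ∀ (f : Pt N → ℕ) → + (∑ N λ i → ∑ N λ j → f (i , j)) ≡ ∑[ x ∈ points N ] (+ f x)
    +∑² f = begin
      + (∑ N λ i → ∑ N λ j → f (i , j))                ≡⟨ +∑ (λ i → ∑ N λ j → f (i , j)) ⟩
      ∑[ i ∈ allFin N ] (+ ∑ N λ j → f (i , j))         ≡⟨ ∑-cong (allFin N) (λ i → +∑ (λ j → f (i , j))) ⟩
      ∑[ i ∈ allFin N ] ∑[ j ∈ allFin N ] (+ f (i , j)) ≡⟨ ∑-cartesianProduct (allFin N) (allFin N) (λ x → + f x) ⟨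
      ∑[ x ∈ points N ] (+ f x)                         ∎
      where open ≡-Reasoning

    +∑⁴ : ∀ (f : Motion N → ℕ) →
      + (∑ N λ a → ∑ N λ b → ∑ N λ z₁ → ∑ N λ z₂ → f (a , b , z₁ , z₂)) ≡ ∑[ m ∈ motions N ] (+ f m)
    +∑⁴ f = begin
      + (∑ N λ a → ∑ N λ b → ∑ N λ z₁ → ∑ N λ z₂ → f (a , b , z₁ , z₂))
        ≡⟨ +∑ _ ⟩
      ∑[ a ∈ allFin N ] (+ ∑ N λ b → ∑ N λ z₁ → ∑ N λ z₂ → f (a , b , z₁ , z₂))
        ≡⟨ ∑-cong (allFin N) (λ a → +∑ _) ⟩
      ∑[ a ∈ allFin N ] ∑[ b ∈ allFin N ] (+ ∑ N λ z₁ → ∑ N λ z₂ → f (a , b , z₁ , z₂))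
        ≡⟨ ∑-cong (allFin N) (λ a → ∑-cong (allFin N) (λ b → +∑² (λ z → f (a , b , z)))) ⟩
      ∑[ a ∈ allFin N ] ∑[ b ∈ allFin N ] ∑[ z ∈ points N ] (+ f (a , b , z))
        ≡⟨ ∑-cong (allFin N) (λ a → ∑-cartesianProduct (allFin N) (points N) (λ bz → + f (a , bz))) ⟨
      ∑[ a ∈ allFin N ] ∑[ bz ∈ cartesianProduct (allFin N) (points N) ] (+ f (a , bz))
        ≡⟨ ∑-cartesianProduct (allFin N) _ (λ m → + f m) ⟨
      ∑[ m ∈ motions N ] (+ f m) ∎
      where open ≡-Reasoning

    +cardMotion : ∀ R → + cardMotion N R ≡ cardᶻ R
    +cardMotion R = +∑⁴ (λ m → ind (R m))

    +cardPt*cardPt : ∀ A B →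
      + (cardPt N A ℕ.* cardPt N B) ≡ ∑[ xy ∈ pairs N ] (𝟙 (A (proj₁ xy)) * 𝟙 (B (proj₂ xy)))
    +cardPt*cardPt A B = begin
      + (cardPt N A ℕ.* cardPt N B)
        ≡⟨ pos-* (cardPt N A) (cardPt N B) ⟩
      + cardPt N A * + cardPt N B
        ≡⟨ cong₂ _*_ (+∑² (λ x → ind (A x))) (+∑² (λ y → ind (B y))) ⟩
      ∑[ x ∈ points N ] 𝟙 (A x) * ∑[ y ∈ points N ] 𝟙 (B y)
        ≡⟨ ∑-product (points N) (points N) (λ x → 𝟙 (A x)) (λ y → 𝟙 (B y)) ⟨
      ∑[ x ∈ points N ] ∑[ y ∈ points N ] (𝟙 (A x) * 𝟙 (B y))
        ≡⟨ ∑-pairs (λ x y → 𝟙 (A x) * 𝟙 (B y)) ⟨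
      ∑[ xy ∈ pairs N ] (𝟙 (A (proj₁ xy)) * 𝟙 (B (proj₂ xy))) ∎
      where open ≡-Reasoning

    +incidences : ∀ A B R →
      + incidences N A B R ≡ ∑[ xy ∈ pairs N ] (𝟙 (A (proj₁ xy)) * 𝟙 (B (proj₂ xy)) * multiplicity R xy)
    +incidences A B R = begin
      + incidences N A B R
        ≡⟨ +∑⁴ (λ m → ∑ N λ x₁ → ∑ N λ x₂ → ∑ N λ y₁ → ∑ N λ y₂ → term m (x₁ , x₂) (y₁ , y₂)) ⟩
      ∑[ m ∈ motions N ] (+ (∑ N λ x₁ → ∑ N λ x₂ → ∑ N λ y₁ → ∑ N λ y₂ → term m (x₁ , x₂) (y₁ , y₂)))
        ≡⟨ ∑-cong (motions N) (λ m → trans (+∑² (λ x → ∑ N λ y₁ → ∑ N λ y₂ → term m x (y₁ , y₂)))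
                                           (∑-cong (points N) (λ x → +∑² (term m x)))) ⟩
      ∑[ m ∈ motions N ] ∑[ x ∈ points N ] ∑[ y ∈ points N ] (+ term m x y)
        ≡⟨ ∑-cong (motions N) (λ m → ∑-cong (points N) (λ x → ∑-cong (points N) (λ y →
             𝟙-∧⁴ (R m) (A x) (B y) (incidentB N m x y)))) ⟩
      ∑[ m ∈ motions N ] ∑[ x ∈ points N ] ∑[ y ∈ points N ] summand m x y
        ≡⟨ ∑-cong (motions N) (λ m → ∑-pairs (summand m)) ⟨
      ∑[ m ∈ motions N ] ∑[ xy ∈ pairs N ] summand m (proj₁ xy) (proj₂ xy)
        ≡⟨ ∑-comm (motions N) (pairs N) (λ m xy → summand m (proj₁ xy) (proj₂ xy)) ⟩
      ∑[ xy ∈ pairs N ] ∑[ m ∈ motions N ] summand m (proj₁ xy) (proj₂ xy)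
        ≡⟨ ∑-cong (pairs N) (λ xy → trans
             (∑-cong (motions N) (λ m → regroup-incidence (𝟙 (R m)) (𝟙 (A (proj₁ xy))) (𝟙 (B (proj₂ xy))) _))
             (∑-distribˡ-* (motions N) (𝟙 (A (proj₁ xy)) * 𝟙 (B (proj₂ xy))) _)) ⟩
      ∑[ xy ∈ pairs N ] (𝟙 (A (proj₁ xy)) * 𝟙 (B (proj₂ xy)) * multiplicity R xy) ∎
      where
      open ≡-Reasoning
      term : Motion N → Pt N → Pt N → ℕ
      term m x y = ind (R m ∧ A x ∧ B y ∧ incidentB N m x y)
      summand : Motion N → Pt N → Pt N → ℤ
      summand m x y = 𝟙 (R m) * (𝟙 (A x) * (𝟙 (B y) * incidence m x y))

  private
    p^[7[1+k]∸1] : ∀ p k → let N = p ^ suc k in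
      p ^ (7 ℕ.* suc k ∸ 1) ≡ N ℕ.* N ℕ.* (N ℕ.* N) ℕ.* (N ℕ.* N) ℕ.* p ^ k
    p^[7[1+k]∸1] p k = begin
      p ^ (k ℕ.+ 6 ℕ.* suc k)              ≡⟨ ℕ.^-distribˡ-+-* p k (6 ℕ.* suc k) ⟩
      p ^ k ℕ.* p ^ (6 ℕ.* suc k)          ≡⟨ cong (λ e → p ^ k ℕ.* p ^ e) (ℕ.*-comm 6 (suc k)) ⟩
      p ^ k ℕ.* p ^ (suc k ℕ.* 6)          ≡⟨ cong (p ^ k ℕ.*_) (ℕ.^-*-assoc p (suc k) 6) ⟨
      p ^ k ℕ.* (p ^ suc k) ^ 6            ≡⟨ ℕ.*-comm (p ^ k) _ ⟩
      (p ^ suc k) ^ 6 ℕ.* p ^ k            ≡⟨ cong (ℕ._* p ^ k) (sixth-power (p ^ suc k)) ⟩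
      _                                    ∎
      where
      open ≡-Reasoning
      sixth-power : ∀ n → n ℕ.* (n ℕ.* (n ℕ.* (n ℕ.* (n ℕ.* (n ℕ.* 1))))) ≡ n ℕ.* n ℕ.* (n ℕ.* n) ℕ.* (n ℕ.* n)
      sixth-power = ℕ-Solver.solve-∀

  module _ {p : ℕ} (prime : Prime p) (2<p : 2 ℕ.< p) (k : ℕ) where

    private
      N M : ℕ
      N = p ^ suc k
      M = p ^ k
      instance
        N≢0 : NonZero N
        N≢0 = ℕ.>-nonZero (ℕ.m^n>0 p {{prime⇒nonZero prime}} (suc k))

    incidence-discrepancy : (A B : Pt N → Bool) (R : Motion N → Bool) →
      (∀ a b z → R (a , b , z) ≡ true → IsRot N a b) →
      let D = + (N ℕ.* N ℕ.* incidences N A B R) - + (cardPt N A ℕ.* cardPt N B ℕ.* cardMotion N R)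
      in D * D ≤ + (p ^ (7 ℕ.* suc k ∸ 1) ℕ.* (cardPt N A ℕ.* cardPt N B) ℕ.* cardMotion N R)
    incidence-discrepancy A B R R⊆SO₂ = begin
      D * D
        ≡⟨ cong₂ _*_ D≡ D≡ ⟩
      (N² * I - W * ρ) * (N² * I - W * ρ)
        ≤⟨ discrepancy prime 2<p k R R⊆SO₂ A B ⟩
      W * (N² * N² * N² * + M * ρ)
        ≡⟨ regroup-bound N² (+ M) W ρ ⟩
      N² * N² * N² * + M * W * ρ
        ≡⟨ cong₂ (λ u v → u * v * ρ) (sym +P) (sym (+cardPt*cardPt A B)) ⟩
      + P * + (cardPt N A ℕ.* cardPt N B) * ρ
        ≡⟨ cong₂ _*_ (sym (pos-* P _)) (sym (+cardMotion R)) ⟩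
      + (P ℕ.* (cardPt N A ℕ.* cardPt N B)) * + cardMotion N R
        ≡⟨ pos-* (P ℕ.* _) (cardMotion N R) ⟨
      + (P ℕ.* (cardPt N A ℕ.* cardPt N B) ℕ.* cardMotion N R) ∎
      where
      open ≤-Reasoning
      N² W I ρ : ℤ
      N² = + N * + N
      W  = ∑[ xy ∈ pairs N ] (𝟙 (A (proj₁ xy)) * 𝟙 (B (proj₂ xy)))
      I  = ∑[ xy ∈ pairs N ] (𝟙 (A (proj₁ xy)) * 𝟙 (B (proj₂ xy)) * multiplicity R xy)
      ρ  = cardᶻ R
      P = p ^ (7 ℕ.* suc k ∸ 1)
      D = + (N ℕ.* N ℕ.* incidences N A B R) - + (cardPt N A ℕ.* cardPt N B ℕ.* cardMotion N R)
      D≡ : D ≡ N² * I - W * ρ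
      D≡ = cong₂ _-_
        (trans (pos-* (N ℕ.* N) _) (cong₂ _*_ (pos-* N N) (+incidences A B R)))
        (trans (pos-* (cardPt N A ℕ.* cardPt N B) _) (cong₂ _*_ (+cardPt*cardPt A B) (+cardMotion R)))
      +P : + P ≡ N² * N² * N² * + M
      +P = trans (cong +_ (p^[7[1+k]∸1] p k))
        (trans (pos-* (N ℕ.* N ℕ.* (N ℕ.* N) ℕ.* (N ℕ.* N)) M)
          (cong (_* + M) (trans (pos-* (N ℕ.* N ℕ.* (N ℕ.* N)) (N ℕ.* N))
            (cong₂ _*_ (trans (pos-* (N ℕ.* N) (N ℕ.* N)) (cong₂ _*_ (pos-* N N) (pos-* N N))) (pos-* N N)))))

open import Defs
open import Data.Nat using (ℕ; _≤_; _<_; _^_; _∸_)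
open import Data.Nat.Primality using (Prime)
open import Data.Integer using (+_) renaming (_*_ to _*ℤ_; _-_ to _-ℤ_; _≤_ to _≤ℤ_)
open import Data.Product using (Σ; _,_)
open import Data.Bool using (Bool; true)
open import Relation.Binary.PropositionalEquality using (_≡_)
open import Data.Nat using (suc) renaming (_*_ to _*ℕ_)
open import Data.Nat.Properties using (*-identityˡ)
open import Relation.Binary.PropositionalEquality using (subst; sym)
open Discrepancy using (incidence-discrepancy)

theorem3p1 : Σ ℕ λ C → (p r : ℕ) → Prime p → 2 < p → 1 ≤ r →
    (A B : Pt (p ^ r) → Bool) → (R : Motion (p ^ r) → Bool) →
    ((a b : _) → (z : Pt (p ^ r)) → R (a , b , z) ≡ true → IsRot (p ^ r) a b) →
    ((+ (p ^ r Data.Nat.* p ^ r Data.Nat.* incidences (p ^ r) A B R)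
        -ℤ + (cardPt (p ^ r) A Data.Nat.* cardPt (p ^ r) B Data.Nat.* cardMotion (p ^ r) R))
     *ℤ
     (+ (p ^ r Data.Nat.* p ^ r Data.Nat.* incidences (p ^ r) A B R)
        -ℤ + (cardPt (p ^ r) A Data.Nat.* cardPt (p ^ r) B Data.Nat.* cardMotion (p ^ r) R)))
    ≤ℤ + (C Data.Nat.* C Data.Nat.* p ^ (7 Data.Nat.* r ∸ 1)
           Data.Nat.* (cardPt (p ^ r) A Data.Nat.* cardPt (p ^ r) B)
           Data.Nat.* cardMotion (p ^ r) R)
theorem3p1 = 1 , λ where
  p (suc k) p-prime 2<p _ A B R R⊆SO₂ →
    let N = p ^ suc k
        D = + (N *ℕ N *ℕ incidences N A B R) -ℤ + (cardPt N A *ℕ cardPt N B *ℕ cardMotion N R)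
    in subst (λ c → D *ℤ D ≤ℤ + (c *ℕ (cardPt N A *ℕ cardPt N B) *ℕ cardMotion N R))
             (sym (*-identityˡ (p ^ (7 *ℕ suc k ∸ 1))))
             (incidence-discrepancy p-prime 2<p k A B R R⊆SO₂)
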